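{- Let $q\ge9$ with $q\equiv0\pmod3$. For $\mu\in\mathbb{F}_q$ let $\ell_\mu$ be the line through $\mathrm{P}(0,\mu,0,1)$ and $\mathrm{P}(1,0,1,0)$. (i) For $\mu,\mu'\in\mathbb{F}_q\setminus\{0,1\}$ with $\mu\neq\mu'$, the lines $\ell_\mu$ and $\ell_{\mu'}$ belong to the same orbit of $G_q$ if and only if $\mu=d^4$ and $\mu'=d^4+d^2+1$ for some $d\in\mathbb{F}_q\setminus\{0,1,-1\}$ such that $1-d^2$ is a square in $\mathbb{F}_q$ and, if $q\equiv1\pmod4$, $d\neq\pm\sqrt{ -1}$. (ii) The lines $\ell_\mu$ with $\mu\in\mathbb{F}_q\setminus\{0,1\}$ a non-square in $\mathbb{F}_q$ belong to pairwise distinct orbits of $G_q$. (iii) Consider the lines $\ell_\mu$ with $\mu\in\mathbb{F}_q\setminus\{0,1\}$ a square. If $q\equiv-1\pmod4$, at most two such lines belong to the same orbit of $G_q$, and there are $(q-3)/8$ pairs of such lines belonging to the same orbit. If $q\equiv1\pmod4$, at most three such lines belong to the same orbit of $G_q$, and there are $(q-9)/8$ pairs of such lines belonging to the same orbit.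
   Context: $\mathrm{P}(x_0,x_1,x_2,x_3)$ denotes a point of $\mathrm{PG}(3,q)$ in homogeneous coordinates. The twisted cubic is $\mathcal{C}=\{P(t): t\in\mathbb{F}_q\cup\{\infty\}\}$, $P(t)=\mathrm{P}(t^3,t^2,t,1)$ for $t\in\mathbb{F}_q$, $P(\infty)=\mathrm{P}(1,0,0,0)$. $G_q$ is the group of projectivities of $\mathrm{PG}(3,q)$ mapping $\mathcal{C}$ onto itself; for $q\ge5$ its elements are exactly the maps $\mathrm{P}(x)\mapsto\mathrm{P}(xM)$ ($x$ a row vector) with $M=\begin{pmatrix} a^3&a^2c&ac^2&c^3\\ 3a^2b&a^2d+2abc&bc^2+2acd&3c^2d\\ 3ab^2&b^2c+2abd&ad^2+2bcd&3cd^2\\ b^3&b^2d&bd^2&d^3\end{pmatrix}$, $a,b,c,d\in\mathbb{F}_q$, $ad-bc\ne0$. -}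

module Defs where

open import Data.Nat using (ℕ)
open import Data.Fin using (Fin; zero; suc)
open import Data.Product using (Σ; ∃; _×_; _,_)
open import Data.List using (List; length)
open import Data.List.Membership.Propositional using (_∈_)
open import Data.List.Relation.Unary.Unique.Propositional using (Unique)
open import Relation.Binary.PropositionalEquality using (_≡_; _≢_)
open import Algebra.Structures using (IsCommutativeRing)

record FiniteField : Set₁ where
  infixl 6 _+_ _-_
  infixl 7 _*_
  field
    Carrier : Set
    _+_ _*_ : Carrier → Carrier → Carrier
    -_      : Carrier → Carrier
    0# 1#   : Carrier
    isCommutativeRing : IsCommutativeRing _≡_ _+_ _*_ -_ 0# 1#
    0≢1     : 0# ≢ 1#
    inverse : ∀ x → x ≢ 0# → ∃ λ y → x * y ≡ 1#
    elements : List Carrier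
    elements-unique : Unique elements
    elements-complete : ∀ x → x ∈ elements

  _-_ : Carrier → Carrier → Carrier
  x - y = x + (- y)

  order : ℕ
  order = length elements

HasSize : {A : Set} → (A → Set) → ℕ → Set
HasSize {A} P n = Σ (List A) λ L →
  (length L ≡ n) × Unique L × (∀ x → (x ∈ L → P x) × (P x → x ∈ L))

module FF (F : FiniteField) where
  open FiniteField F

  2# 3# : Carrier
  2# = 1# + 1#
  3# = 1# + 1# + 1#

  IsSquare : Carrier → Set
  IsSquare x = ∃ λ y → y * y ≡ x

  -- row vectors of F^4 (homogeneous coordinates of PG(3,q))
  V4 : Set
  V4 = Fin 4 → Carrier

  mkV : Carrier → Carrier → Carrier → Carrier → V4
  mkV x0 x1 x2 x3 zero = x0
  mkV x0 x1 x2 x3 (suc zero) = x1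
  mkV x0 x1 x2 x3 (suc (suc zero)) = x2
  mkV x0 x1 x2 x3 (suc (suc (suc zero))) = x3

  M : Carrier → Carrier → Carrier → Carrier → Fin 4 → V4
  M a b c d zero =
    mkV (a * a * a) (a * a * c) (a * c * c) (c * c * c)
  M a b c d (suc zero) =
    mkV (3# * a * a * b) (a * a * d + 2# * a * b * c)
        (b * c * c + 2# * a * c * d) (3# * c * c * d)
  M a b c d (suc (suc zero)) =
    mkV (3# * a * b * b) (b * b * c + 2# * a * b * d)
        (a * d * d + 2# * b * c * d) (3# * c * d * d)
  M a b c d (suc (suc (suc zero))) =
    mkV (b * b * b) (b * b * d) (b * d * d) (d * d * d)

  act : Carrier → Carrier → Carrier → Carrier → V4 → V4
  act a b c d x j =
    x zero * M a b c d zero j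
    + x (suc zero) * M a b c d (suc zero) j
    + x (suc (suc zero)) * M a b c d (suc (suc zero)) j
    + x (suc (suc (suc zero))) * M a b c d (suc (suc (suc zero))) j

  -- x lies in the span of u and v (i.e. P(x) lies on the line P(u)P(v), for x ≠ 0)
  InSpan : V4 → V4 → V4 → Set
  InSpan u v x = ∃ λ s → ∃ λ t → ∀ i → x i ≡ s * u i + t * v i

  OnLine : Carrier → V4 → Set
  OnLine μ = InSpan (mkV 0# μ 0# 1#) (mkV 1# 0# 1# 0#)

  -- ℓ_μ and ℓ_μ' lie in the same G_q-orbit: some projectivity of G_q
  -- (x ↦ x M(a,b,c,d), ad - bc ≠ 0) maps the point set of ℓ_μ onto that of ℓ_μ'
  SameOrbit : Carrier → Carrier → Set
  SameOrbit μ μ' = ∃ λ a → ∃ λ b → ∃ λ c → ∃ λ d →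
    (a * d - b * c ≢ 0#) ×
    (∀ x → (OnLine μ x → OnLine μ' (act a b c d x))
         × (OnLine μ' (act a b c d x) → OnLine μ x))

  Adm : Carrier → Set
  Adm μ = (μ ≢ 0#) × (μ ≢ 1#)

-- As 3 ∣ q, the field has characteristic 3. The line ℓ_μ' has equations x₀ = x₂, x₁ = μ'x₃,
-- and ℓ_μ is spanned by u = (0,μ,0,1) and v = (1,0,1,0), so M(a,b,c,d) maps ℓ_μ onto ℓ_μ'
-- only if uM and vM satisfy them. After scaling to c = 1 (c = 0 is impossible), eliminating
-- b, μ and μ' leaves a²(1 − a² − d²)(d² − a²)(1 − a²)² = 0; every factor but 1 − a² − d²
-- contradicts μ ∉ {0, 1, μ'}, and a² + d² = 1 forces μ = d⁴ and μ' = d⁴ + d² + 1.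
-- Conversely M(r, −rd, 1, d) with r² = 1 − d² maps ℓ_{d⁴} onto ℓ_{d⁴+d²+1}.
-- Hence μ = s² and μ' = s² + s + 1 for the square s = d². As μ determines s up to sign,
-- ℓ_μ has at most two partners, and two partners ±s force −1 to be a square.
-- For the count, (u, v) ↦ (u⁴, u⁴ + u² + 1) maps the points of u² + v² = 1 with uv ≠ 0 and
-- u² ≠ −1 four-to-one onto the related pairs. Stereographic projection from (−1, 0) leaves
-- q − n further points on the circle, n ∈ {0, 2} being the number of square roots of −1;
-- removing (1, 0), (0, ±1) and the n² points with u² = −1 gives 4m = q − 3 − n − n² for the
-- number m of related pairs, which is even because swapping a pair is a fixed-point-free
-- involution. In particular n = 2 exactly when q ≡ 1 (mod 4).

module Submission where

open import Defs
open import Data.Nat using (ℕ; _≤_; _<_; _%_; _/_; _∸_; s≤s; z≤n) renaming (_*_ to _*ℕ_; _+_ to _+ℕ_)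
import Data.Nat.Properties as ℕ
open import Data.Nat.Divisibility using (_∣_; divides; _∣0; ∣-reflexive; ∣m∣n⇒∣m+n; ∣m⇒∣m*n; ∣m+n∣m⇒∣n; ∣1⇒≡1; m%n≡0⇒n∣m)
open import Data.Product using (∃; ∃₂; _×_; _,_; proj₁; proj₂)
open import Data.Product.Properties using (≡-dec)
open import Data.Sum using (_⊎_; inj₁; inj₂; [_,_]′)
open import Data.Empty using (⊥; ⊥-elim)
open import Data.Unit using (⊤; tt)
open import Data.List using (List; []; _∷_; length; filter; cartesianProduct; map)
open import Data.List.Membership.Propositional using (_∈_; lose)
open import Data.List.Relation.Unary.Any using (here; there; any?; satisfied)
open import Data.List.Relation.Unary.All using ([]; _∷_)
import Data.List.Relation.Unary.All as All
open import Data.List.Relation.Unary.AllPairs using ([]; _∷_)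
open import Data.List.Relation.Unary.Unique.Propositional using (Unique)
open import Function.Base using (_∘_)
open import Level using (0ℓ)
open import Relation.Nullary using (¬_; Dec; yes; no; ¬?)
open import Relation.Nullary.Decidable using (_×-dec_; _→-dec_)
open import Relation.Unary using (Pred; Decidable; _∩_; _∖_)
open import Relation.Binary.Definitions using (DecidableEquality)
open import Relation.Binary.PropositionalEquality using (_≡_; _≢_; refl; sym; trans; cong; cong₂; subst; module ≡-Reasoning)

module Counting where

  open import Data.Nat using (suc; _+_; _*_)
  open import Data.Nat.Properties using (+-suc; m+n∸m≡n; m<n+m; *-suc; *-zeroʳ)
  open import Data.Nat.Induction using (<-wellFounded)
  open import Induction.WellFounded using (Acc; acc)
  open import Data.List.Properties using (length-++; length-map)
  open import Data.List.Membership.Propositional.Properties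
    using (∈-filter⁺; ∈-filter⁻; ∈-cartesianProduct⁺; ∈-cartesianProduct⁻)
  open import Data.List.Membership.Propositional.Properties.WithK using (unique∧set⇒bag)
  open import Data.List.Relation.Binary.BagAndSetEquality using (∼bag⇒↭)
  open import Data.List.Relation.Binary.Permutation.Propositional.Properties using (↭-length)
  import Data.List.Relation.Unary.Unique.Propositional.Properties as Unique
  open import Function.Bundles using (mk⇔)

  module _ {A : Set} where

    private variable
      P Q R : Pred A 0ℓ
      m n : ℕ

    HasSize-unique : HasSize P m → HasSize P n → m ≡ n
    HasSize-unique (L , refl , L-unique , L-spec) (M , refl , M-unique , M-spec) =
      ↭-length (∼bag⇒↭ (unique∧set⇒bag L-unique M-unique (mk⇔ L⊆M M⊆L)))
      where
      L⊆M : ∀ {x} → x ∈ L → x ∈ M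
      L⊆M {x} x∈L = proj₂ (M-spec x) (proj₁ (L-spec x) x∈L)
      M⊆L : ∀ {x} → x ∈ M → x ∈ L
      M⊆L {x} x∈M = proj₂ (L-spec x) (proj₁ (M-spec x) x∈M)

    HasSize-cong : (∀ {x} → P x → Q x) → (∀ {x} → Q x → P x) → HasSize P n → HasSize Q n
    HasSize-cong P⇒Q Q⇒P (L , L-length , L-unique , L-spec) =
      L , L-length , L-unique , λ x → (λ x∈L → P⇒Q (proj₁ (L-spec x) x∈L)) , λ Qx → proj₂ (L-spec x) (Q⇒P Qx)

    HasSize-∈ : {L : List A} → Unique L → HasSize (_∈ L) (length L)
    HasSize-∈ {L = L} L-unique = L , refl , L-unique , λ _ → (λ x∈L → x∈L) , λ x∈L → x∈L

    HasSize-empty : HasSize P n → (∀ {x} → ¬ P x) → n ≡ 0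
    HasSize-empty ([] , refl , _) _ = refl
    HasSize-empty (x ∷ L , refl , _ , L-spec) ¬P = ⊥-elim (¬P (proj₁ (L-spec x) (here refl)))

    HasSize-filter : ∀ {U : Pred A 0ℓ} {N} → HasSize U N → (∀ x → U x) → Decidable P → ∃ (HasSize P)
    HasSize-filter (L , _ , L-unique , L-spec) U-total P? =
      length (filter P? L) , filter P? L , refl , Unique.filter⁺ P? L-unique ,
      λ x → (λ x∈ → proj₂ (∈-filter⁻ P? {xs = L} x∈)) , ∈-filter⁺ P? (proj₂ (L-spec x) (U-total x))

    length-filter-∁ : (R? : Decidable R) (L : List A) →
                      length (filter R? L) + length (filter (¬? ∘ R?) L) ≡ length L
    length-filter-∁ R? [] = refl
    length-filter-∁ R? (x ∷ L) with R? x
    ... | yes _ = cong suc (length-filter-∁ R? L)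
    ... | no _ = trans (+-suc (length (filter R? L)) _) (cong suc (length-filter-∁ R? L))

    HasSize-partition : Decidable R → HasSize P n →
                        ∃₂ λ r s → HasSize (P ∩ R) r × HasSize (P ∖ R) s × r + s ≡ n
    HasSize-partition {R = R} {P = P} R? (L , refl , L-unique , L-spec) =
      length (filter R? L) , length (filter ¬R? L) ,
      (filter R? L , refl , Unique.filter⁺ R? L-unique , spec R?) ,
      (filter ¬R? L , refl , Unique.filter⁺ ¬R? L-unique , spec ¬R?) ,
      length-filter-∁ R? L
      where
      ¬R? : Decidable (λ x → ¬ R x)
      ¬R? = ¬? ∘ R?
      spec : ∀ {S : Pred _ _} (S? : Decidable S) x → (x ∈ filter S? L → (P ∩ S) x) × ((P ∩ S) x → x ∈ filter S? L)
      spec S? x = (λ x∈ → let (x∈L , Sx) = ∈-filter⁻ S? {xs = L} x∈ in proj₁ (L-spec x) x∈L , Sx)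
                , λ (Px , Sx) → ∈-filter⁺ S? (proj₂ (L-spec x) Px) Sx

    HasSize-∖ : {r : ℕ} → Decidable R → HasSize P n → HasSize (P ∩ R) r → HasSize (P ∖ R) (n ∸ r)
    HasSize-∖ R? P-size P∩R-size with HasSize-partition R? P-size
    ... | r , s , P∩R-size′ , P∖R-size , refl
      rewrite HasSize-unique P∩R-size P∩R-size′ | m+n∸m≡n r s = P∖R-size

    record Blocks (P : Pred A 0ℓ) (k : ℕ) : Set where
      field
        block        : A → List A
        block-unique : ∀ {x} → P x → Unique (block x)
        block-length : ∀ {x} → P x → length (block x) ≡ k
        block-self   : ∀ {x} → P x → x ∈ block x
        block-closed : ∀ {x y} → P x → y ∈ block x → P y
        block-sym    : ∀ {x y} → P x → y ∈ block x → x ∈ block y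
        block-trans  : ∀ {x y z} → P x → y ∈ block x → z ∈ block y → z ∈ block x

    module _ {P : Pred A 0ℓ} (σ : A → A) (σ-closed : ∀ {x} → P x → P (σ x))
             (σ-fixpoint-free : ∀ {x} → P x → σ x ≢ x) where

      involution-Blocks : (∀ x → σ (σ x) ≡ x) → Blocks P 2
      involution-Blocks σ²≡id = record
        { block        = λ x → x ∷ σ x ∷ []
        ; block-unique = λ Px → ((λ x≡σx → σ-fixpoint-free Px (sym x≡σx)) ∷ []) ∷ [] ∷ []
        ; block-length = λ _ → refl
        ; block-self   = λ _ → here refl
        ; block-closed = closed
        ; block-sym    = λ { _ (here refl) → here refl ; _ (there (here refl)) → there (here (sym (σ²≡id _))) }
        ; block-trans  = trans′
        }
        where
        closed : ∀ {x y} → P x → y ∈ x ∷ σ x ∷ [] → P y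
        closed Px (here refl) = Px
        closed Px (there (here refl)) = σ-closed Px
        trans′ : ∀ {x y z} → P x → y ∈ x ∷ σ x ∷ [] → z ∈ y ∷ σ y ∷ [] → z ∈ x ∷ σ x ∷ []
        trans′ _ (here refl) z∈ = z∈
        trans′ _ (there (here refl)) (here refl) = there (here refl)
        trans′ _ (there (here refl)) (there (here refl)) = here (σ²≡id _)

      order-3-Blocks : (∀ x → σ (σ (σ x)) ≡ x) → Blocks P 3
      order-3-Blocks σ³≡id = record
        { block        = orbit
        ; block-unique = λ Px → (x≢σx Px ∷ x≢σ²x Px ∷ []) ∷ (x≢σx (σ-closed Px) ∷ []) ∷ [] ∷ []
        ; block-length = λ _ → refl
        ; block-self   = λ _ → here refl
        ; block-closed = closed
        ; block-sym    = sym′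
        ; block-trans  = trans′
        }
        where
        orbit : A → List A
        orbit x = x ∷ σ x ∷ σ (σ x) ∷ []
        x≢σx : ∀ {x} → P x → x ≢ σ x
        x≢σx Px x≡σx = σ-fixpoint-free Px (sym x≡σx)
        x≢σ²x : ∀ {x} → P x → x ≢ σ (σ x)
        x≢σ²x {x} Px x≡σ²x = σ-fixpoint-free Px (trans (cong σ x≡σ²x) (σ³≡id x))
        closed : ∀ {x y} → P x → y ∈ orbit x → P y
        closed Px (here refl) = Px
        closed Px (there (here refl)) = σ-closed Px
        closed Px (there (there (here refl))) = σ-closed (σ-closed Px)
        sym′ : ∀ {x y} → P x → y ∈ orbit x → x ∈ orbit y
        sym′ _ (here refl) = here refl
        sym′ _ (there (here refl)) = there (there (here (sym (σ³≡id _))))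
        sym′ _ (there (there (here refl))) = there (here (sym (σ³≡id _)))
        trans′ : ∀ {x y z} → P x → y ∈ orbit x → z ∈ orbit y → z ∈ orbit x
        trans′ _ (here refl) z∈ = z∈
        trans′ _ (there (here refl)) (here refl) = there (here refl)
        trans′ _ (there (here refl)) (there (here refl)) = there (there (here refl))
        trans′ _ (there (here refl)) (there (there (here refl))) = here (σ³≡id _)
        trans′ _ (there (there (here refl))) (here refl) = there (there (here refl))
        trans′ _ (there (there (here refl))) (there (here refl)) = here (σ³≡id _)
        trans′ _ (there (there (here refl))) (there (there (here refl))) = there (here (cong σ (σ³≡id _)))

    module _ (_≟_ : DecidableEquality A) {k : ℕ} where
      open import Data.List.Membership.DecPropositional _≟_ using (_∈?_)

      Blocks-∖ : ∀ {P x} (𝓑 : Blocks P k) → P x → Blocks (P ∖ (_∈ Blocks.block 𝓑 x)) k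
      Blocks-∖ {x = x} 𝓑 Px = record
        { block        = block
        ; block-unique = λ (Py , _) → block-unique Py
        ; block-length = λ (Py , _) → block-length Py
        ; block-self   = λ (Py , _) → block-self Py
        ; block-closed = λ (Py , y∉) z∈ →
            block-closed Py z∈ , λ z∈x → y∉ (block-trans Px z∈x (block-sym Py z∈))
        ; block-sym    = λ (Py , _) → block-sym Py
        ; block-trans  = λ (Py , _) → block-trans Py
        }
        where open Blocks 𝓑

      Blocks⇒∣ : ∀ {P n} → Blocks P k → HasSize P n → k ∣ n
      Blocks⇒∣ = go (<-wellFounded _)
        where
        go : ∀ {P n} → Acc _<_ n → Blocks P k → HasSize P n → k ∣ n
        go _ _ ([] , refl , _) = k ∣0
        go (acc rec) 𝓑 P-size@(x ∷ _ , refl , _ , L-spec)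
          with HasSize-partition (_∈? Blocks.block 𝓑 x) P-size
        ... | r , s , inside , outside , r+s≡n =
          subst (k ∣_) r+s≡n (∣m∣n⇒∣m+n (∣-reflexive (sym r≡k)) (go (rec s<n) (Blocks-∖ 𝓑 Px) outside))
          where
          open Blocks 𝓑
          Px = proj₁ (L-spec x) (here refl)
          r≡k : r ≡ k
          r≡k = trans (HasSize-unique inside (HasSize-cong (λ y∈ → block-closed Px y∈ , y∈) proj₂
                                               (HasSize-∈ (block-unique Px))))
                      (block-length Px)
          0<r : 0 < r
          0<r = subst (0 <_) (sym r≡k) (subst (0 <_) (block-length Px) (∈⇒length> (block-self Px)))
            where
            ∈⇒length> : ∀ {y L} → y ∈ L → 0 < length L
            ∈⇒length> (here _)  = s≤s z≤n
            ∈⇒length> (there _) = s≤s z≤n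
          s<n : s < _
          s<n = subst (s <_) r+s≡n (m<n+m s 0<r)

  module _ {A B : Set} where

    private variable
      P : Pred A 0ℓ
      Q : Pred B 0ℓ
      m n k : ℕ

    length-cartesianProduct : (xs : List A) (ys : List B) →
                              length (cartesianProduct xs ys) ≡ length xs * length ys
    length-cartesianProduct [] ys = refl
    length-cartesianProduct (x ∷ xs) ys =
      trans (length-++ (map (x ,_) ys)) (cong₂ _+_ (length-map _ ys) (length-cartesianProduct xs ys))

    HasSize-× : HasSize P m → HasSize Q n → HasSize (λ (p : A × B) → P (proj₁ p) × Q (proj₂ p)) (m * n)
    HasSize-× (L , refl , L-unique , L-spec) (M , refl , M-unique , M-spec) =
      cartesianProduct L M , length-cartesianProduct L M , Unique.cartesianProduct⁺ L-unique M-unique ,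
      λ (x , y) → (λ p∈ → let (x∈ , y∈) = ∈-cartesianProduct⁻ L M p∈ in proj₁ (L-spec x) x∈ , proj₁ (M-spec y) y∈)
                , λ (Px , Qy) → ∈-cartesianProduct⁺ (proj₂ (L-spec x) Px) (proj₂ (M-spec y) Qy)

    HasSize-fibres : DecidableEquality B → (f : A → B) →
                     HasSize P n → HasSize Q m → (∀ {x} → P x → Q (f x)) →
                     (∀ {y} → Q y → HasSize (λ x → P x × f x ≡ y) k) → n ≡ k * m
    HasSize-fibres {k = k} _≟_ f P-size (M , refl , M-unique , M-spec) P⇒Q fibre =
      go M M-unique P-size (λ Px → proj₂ (M-spec _) (P⇒Q Px)) (λ y∈M → fibre (proj₁ (M-spec _) y∈M))
      where
      go : ∀ M → Unique M → ∀ {P n} → HasSize P n → (∀ {x} → P x → f x ∈ M) →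
           (∀ {y} → y ∈ M → HasSize (λ x → P x × f x ≡ y) k) → n ≡ k * length M
      go [] _ P-size P⇒M _ = trans (HasSize-empty P-size (λ Px → ∉[] (P⇒M Px))) (sym (*-zeroʳ k))
        where
        ∉[] : ∀ {y} → ¬ y ∈ []
        ∉[] ()
      go (y ∷ M) (y∉M ∷ M-unique) {P} P-size P⇒M fibre
        with HasSize-partition (λ x → f x ≟ y) P-size
      ... | r , s , over-y , elsewhere , refl =
        trans (cong₂ _+_ (HasSize-unique over-y (fibre (here refl))) (go M M-unique elsewhere P∖y⇒M fibre′))
              (sym (*-suc k (length M)))
        where
        P∖y⇒M : ∀ {x} → P x × f x ≢ y → f x ∈ M
        P∖y⇒M (Px , fx≢y) with P⇒M Px
        ... | here fx≡y = ⊥-elim (fx≢y fx≡y)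
        ... | there fx∈M = fx∈M
        fibre′ : ∀ {y′} → y′ ∈ M → HasSize (λ x → (P x × f x ≢ y) × f x ≡ y′) k
        fibre′ y′∈M = HasSize-cong (λ (Px , fx≡y′) → (Px , λ fx≡y → All.lookup y∉M y′∈M (trans (sym fx≡y) fx≡y′)) , fx≡y′)
                                   (λ ((Px , _) , fx≡y′) → Px , fx≡y′)
                                   (fibre (there y′∈M))

module FieldProperties (F : FiniteField) where

  open import Algebra.Bundles using (CommutativeRing)

  open FiniteField F
  open FF F
  open Counting

  commutativeRing : CommutativeRing _ _
  commutativeRing = record { isCommutativeRing = isCommutativeRing }

  open CommutativeRing commutativeRing public
    using (+-assoc; +-comm; +-identityˡ; +-identityʳ; *-assoc; *-comm; *-identityˡ; *-identityʳ; distribʳ;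
           -‿inverseˡ; -‿inverseʳ; zeroˡ; zeroʳ)
  open import Algebra.Properties.Ring (CommutativeRing.ring commutativeRing) public
    using (-‿involutive; -0#≈0#; -1*x≈-x)
  open import Algebra.Properties.AbelianGroup (CommutativeRing.+-abelianGroup commutativeRing) public
    using (x∙y⁻¹≈ε⇒x≈y; x≈y⇒x∙y⁻¹≈ε; ⁻¹-injective; ⁻¹-∙-comm; inverseʳ-unique; inverseˡ-unique)

  infix 4 _≟_
  _≟_ : DecidableEquality Carrier
  x ≟ y = decide elements-unique (elements-complete x) (elements-complete y)
    where
    decide : ∀ {L} → Unique L → x ∈ L → y ∈ L → Dec (x ≡ y)
    decide _ (here refl) (here refl) = yes refl
    decide (z∉L ∷ _) (here refl) (there y∈L) = no λ { refl → All.lookup z∉L y∈L refl }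
    decide (z∉L ∷ _) (there x∈L) (here refl) = no λ { refl → All.lookup z∉L x∈L refl }
    decide (_ ∷ L-unique) (there x∈L) (there y∈L) = decide L-unique x∈L y∈L

  ∃? : {P : Carrier → Set} → Decidable P → Dec (∃ P)
  ∃? P? with any? P? elements
  ... | yes some = yes (satisfied some)
  ... | no none = no λ (x , Px) → none (lose (elements-complete x) Px)

  IsSquare? : Decidable IsSquare
  IsSquare? x = ∃? (λ y → y * y ≟ x)

  HasSize-Carrier : HasSize (λ (_ : Carrier) → ⊤) order
  HasSize-Carrier = elements , refl , elements-unique , λ x → (λ _ → tt) , λ _ → elements-complete x

  Point : Set
  Point = Carrier × Carrier

  _≟ₚ_ : DecidableEquality Point
  _≟ₚ_ = ≡-dec _≟_ _≟_

  HasSize-Point : HasSize (λ (_ : Point) → ⊤) (order *ℕ order)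
  HasSize-Point = HasSize-cong (λ _ → tt) (λ _ → tt , tt) (HasSize-× HasSize-Carrier HasSize-Carrier)

  x-y≡0⇒x≡y : ∀ {x y} → x - y ≡ 0# → x ≡ y
  x-y≡0⇒x≡y = x∙y⁻¹≈ε⇒x≈y _ _

  x≡y⇒x-y≡0 : ∀ {x y} → x ≡ y → x - y ≡ 0#
  x≡y⇒x-y≡0 = x≈y⇒x∙y⁻¹≈ε

  -x≡0⇒x≡0 : ∀ {x} → - x ≡ 0# → x ≡ 0#
  -x≡0⇒x≡0 -x≡0 = ⁻¹-injective (trans -x≡0 (sym -0#≈0#))

  x≢0⇒-x≢0 : ∀ {x} → x ≢ 0# → - x ≢ 0#
  x≢0⇒-x≢0 x≢0 -x≡0 = x≢0 (-x≡0⇒x≡0 -x≡0)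

  1≢0 : 1# ≢ 0#
  1≢0 1≡0 = 0≢1 (sym 1≡0)

  -1≢0 : - 1# ≢ 0#
  -1≢0 = x≢0⇒-x≢0 1≢0

  -- Given an identity t ≡ k₁ * g₁ + ⋯ + kₙ * gₙ, the term trans identity (⟨ g₁≡0 ⟩ ⊕ ⋯ ⊕ ⟨ gₙ≡0 ⟩)
  -- proves t ≡ 0#; the algebraic steps below are all of this form.
  infixl 6 _⊕_

  _⊕_ : ∀ {x y} → x ≡ 0# → y ≡ 0# → x + y ≡ 0#
  x≡0 ⊕ y≡0 = trans (cong₂ _+_ x≡0 y≡0) (+-identityʳ 0#)

  ⟨_⟩ : ∀ {k g} → g ≡ 0# → k * g ≡ 0#
  ⟨_⟩ {k} g≡0 = trans (cong (k *_) g≡0) (zeroʳ k)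

  x*y≡0⇒y≡0 : ∀ {x y} → x ≢ 0# → x * y ≡ 0# → y ≡ 0#
  x*y≡0⇒y≡0 {x} {y} x≢0 xy≡0 = let (x⁻¹ , xx⁻¹≡1) = inverse x x≢0 in
    begin
      y              ≡⟨ sym (*-identityˡ y) ⟩
      1# * y         ≡⟨ cong (_* y) (trans (sym xx⁻¹≡1) (*-comm x x⁻¹)) ⟩
      x⁻¹ * x * y    ≡⟨ *-assoc x⁻¹ x y ⟩
      x⁻¹ * (x * y)  ≡⟨ cong (x⁻¹ *_) xy≡0 ⟩
      x⁻¹ * 0#       ≡⟨ zeroʳ x⁻¹ ⟩
      0#             ∎
    where open ≡-Reasoning

  x*y≡0⇒x≡0 : ∀ {x y} → y ≢ 0# → x * y ≡ 0# → x ≡ 0#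
  x*y≡0⇒x≡0 {x} {y} y≢0 xy≡0 = x*y≡0⇒y≡0 y≢0 (trans (*-comm y x) xy≡0)

  x*y≡0⇒x≡0⊎y≡0 : ∀ {x y} → x * y ≡ 0# → x ≡ 0# ⊎ y ≡ 0#
  x*y≡0⇒x≡0⊎y≡0 {x} xy≡0 with x ≟ 0#
  ... | yes x≡0 = inj₁ x≡0
  ... | no x≢0 = inj₂ (x*y≡0⇒y≡0 x≢0 xy≡0)

  x*y≢0 : ∀ {x y} → x ≢ 0# → y ≢ 0# → x * y ≢ 0#
  x*y≢0 x≢0 y≢0 xy≡0 = y≢0 (x*y≡0⇒y≡0 x≢0 xy≡0)

  x*x≡0⇒x≡0 : ∀ {x} → x * x ≡ 0# → x ≡ 0#
  x*x≡0⇒x≡0 {x} xx≡0 with x ≟ 0#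
  ... | yes x≡0 = x≡0
  ... | no x≢0 = x*y≡0⇒y≡0 x≢0 xx≡0

  -- 0 ⁻¹ is a junk value 0.
  _⁻¹ : Carrier → Carrier
  x ⁻¹ with x ≟ 0#
  ... | yes _ = 0#
  ... | no x≢0 = proj₁ (inverse x x≢0)

  x*x⁻¹≡1 : ∀ {x} → x ≢ 0# → x * x ⁻¹ ≡ 1#
  x*x⁻¹≡1 {x} x≢0 with x ≟ 0#
  ... | yes x≡0 = ⊥-elim (x≢0 x≡0)
  ... | no x≢0′ = proj₂ (inverse x x≢0′)

module Characteristic (F : FiniteField) where

  open FiniteField F
  open FF F
  open FieldProperties F
  open Counting

  private
    0<order : 1 ≤ order
    0<order with elements | elements-complete 0#
    ... | _ ∷ _ | _ = s≤s z≤n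

    3x≡x+x+x : ∀ x → 3# * x ≡ x + x + x
    3x≡x+x+x x = trans (distribʳ x (1# + 1#) 1#)
      (cong₂ _+_ (trans (distribʳ x 1# 1#) (cong₂ _+_ (*-identityˡ x) (*-identityˡ x))) (*-identityˡ x))

    -[y-[x+y]]≡x : ∀ x y → - (y + - (x + y)) ≡ x
    -[y-[x+y]]≡x x y = begin
      - (y + - (x + y))     ≡⟨ sym (⁻¹-∙-comm y (- (x + y))) ⟩
      - y + - - (x + y)     ≡⟨ cong (- y +_) (trans (-‿involutive (x + y)) (+-comm x y)) ⟩
      - y + (y + x)         ≡⟨ sym (+-assoc (- y) y x) ⟩
      - y + y + x           ≡⟨ cong (_+ x) (-‿inverseˡ y) ⟩
      0# + x                ≡⟨ +-identityˡ x ⟩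
      x                     ∎
      where open ≡-Reasoning

    -[-[x+y]+x]≡y : ∀ x y → - (- (x + y) + x) ≡ y
    -[-[x+y]+x]≡y x y = begin
      - (- (x + y) + x)     ≡⟨ sym (⁻¹-∙-comm (- (x + y)) x) ⟩
      - - (x + y) + - x     ≡⟨ cong (_+ - x) (trans (-‿involutive (x + y)) (+-comm x y)) ⟩
      y + x + - x           ≡⟨ +-assoc y x (- x) ⟩
      y + (x + - x)         ≡⟨ cong (y +_) (-‿inverseʳ x) ⟩
      y + 0#                ≡⟨ +-identityʳ y ⟩
      y                     ∎
      where open ≡-Reasoning

  -- If 3 ≠ 0 then σ(x, y) = (y, −x − y) is a fixed-point-free permutation of order 3 of
  -- F² ∖ {0}, so 3 ∣ q² − 1, which contradicts 3 ∣ q.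
  3∣order⇒3≡0 : 3 ∣ order → 3# ≡ 0#
  3∣order⇒3≡0 3∣q with 3# ≟ 0#
  ... | yes 3≡0 = 3≡0
  ... | no 3≢0 = ⊥-elim (3≢1 (∣1⇒≡1 3∣1))
    where
    3≢1 : 3 ≢ 1
    3≢1 ()

    σ : Point → Point
    σ (x , y) = y , - (x + y)

    σ³≡id : ∀ p → σ (σ (σ p)) ≡ p
    σ³≡id (x , y) = cong₂ _,_ (-[y-[x+y]]≡x x y) (trans (cong (λ z → - (- (x + y) + z)) (-[y-[x+y]]≡x x y)) (-[-[x+y]+x]≡y x y))

    Nonzero : Point → Set
    Nonzero p = p ≢ (0# , 0#)

    σ-closed : ∀ {p} → Nonzero p → Nonzero (σ p)
    σ-closed {x , y} p≢0 σp≡0 with cong proj₁ σp≡0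
    ... | refl = p≢0 (cong (_, 0#) (trans (sym (+-identityʳ x)) (-x≡0⇒x≡0 (cong proj₂ σp≡0))))

    σ-fixpoint-free : ∀ {p} → Nonzero p → σ p ≢ p
    σ-fixpoint-free {x , y} p≢0 σp≡p with cong proj₁ σp≡p
    ... | refl = p≢0 (cong₂ _,_ x≡0 x≡0)
      where
      x≡0 : x ≡ 0#
      x≡0 = x*y≡0⇒y≡0 3≢0 (trans (3x≡x+x+x x)
              (trans (cong (x + x +_) (sym (cong proj₂ σp≡p))) (-‿inverseʳ (x + x))))

    Nonzero-size : HasSize Nonzero (order *ℕ order ∸ 1)
    Nonzero-size = HasSize-cong proj₂ (λ p≢0 → tt , p≢0)
      (HasSize-∖ (_≟ₚ (0# , 0#)) HasSize-Point
        ((0# , 0#) ∷ [] , refl , [] ∷ [] , λ p → (λ { (here refl) → tt , refl }) , λ { (_ , refl) → here refl }))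

    3∣q²-1 : 3 ∣ order *ℕ order ∸ 1
    3∣q²-1 = Blocks⇒∣ _≟ₚ_ (order-3-Blocks σ σ-closed σ-fixpoint-free σ³≡id) Nonzero-size

    3∣1 : 3 ∣ 1
    3∣1 = ∣m+n∣m⇒∣n (subst (3 ∣_) (sym (ℕ.m∸n+n≡m 1≤q²)) (∣m⇒∣m*n order 3∣q)) 3∣q²-1
      where
      1≤q² : 1 ≤ order *ℕ order
      1≤q² = ℕ.*-mono-≤ 0<order 0<order

module Characteristic3 (F : FiniteField) (3≡0 : FF.3# F ≡ FiniteField.0# F) where

  open import Data.Maybe using (Maybe; just; nothing)
  open import Algebra.Bundles using (RawRing)
  open import Algebra.Solver.Ring.AlmostCommutativeRing
    using (fromCommutativeRing; _-Raw-AlmostCommutative⟶_)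

  open FiniteField F
  open FF F
  open FieldProperties F

  -- The ring solver with coefficients in 𝔽₃ normalises the identities valid in characteristic 3.
  data 𝔽₃ : Set where
    0₃ 1₃ -1₃ : 𝔽₃

  _+₃_ : 𝔽₃ → 𝔽₃ → 𝔽₃
  0₃ +₃ y = y
  1₃ +₃ 0₃ = 1₃
  1₃ +₃ 1₃ = -1₃
  1₃ +₃ -1₃ = 0₃
  -1₃ +₃ 0₃ = -1₃
  -1₃ +₃ 1₃ = 0₃
  -1₃ +₃ -1₃ = 1₃

  _*₃_ : 𝔽₃ → 𝔽₃ → 𝔽₃
  0₃ *₃ y = 0₃
  1₃ *₃ y = y
  -1₃ *₃ 0₃ = 0₃
  -1₃ *₃ 1₃ = -1₃
  -1₃ *₃ -1₃ = 1₃

  -₃_ : 𝔽₃ → 𝔽₃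
  -₃ 0₃ = 0₃
  -₃ 1₃ = -1₃
  -₃ -1₃ = 1₃

  𝔽₃-rawRing : RawRing _ _
  𝔽₃-rawRing = record
    { Carrier = 𝔽₃ ; _≈_ = _≡_ ; _+_ = _+₃_ ; _*_ = _*₃_ ; -_ = -₃_ ; 0# = 0₃ ; 1# = 1₃ }

  ⟦_⟧₃ : 𝔽₃ → Carrier
  ⟦ 0₃ ⟧₃ = 0#
  ⟦ 1₃ ⟧₃ = 1#
  ⟦ -1₃ ⟧₃ = - 1#

  1+1≡-1 : 1# + 1# ≡ - 1#
  1+1≡-1 = begin
    1# + 1#                ≡⟨ sym (+-identityʳ _) ⟩
    1# + 1# + 0#           ≡⟨ cong (1# + 1# +_) (sym (-‿inverseʳ 1#)) ⟩
    1# + 1# + (1# + - 1#)  ≡⟨ sym (+-assoc _ 1# (- 1#)) ⟩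
    3# + - 1#              ≡⟨ cong (_+ - 1#) 3≡0 ⟩
    0# + - 1#              ≡⟨ +-identityˡ _ ⟩
    - 1#                   ∎
    where open ≡-Reasoning

  -1+-1≡1 : - 1# + - 1# ≡ 1#
  -1+-1≡1 = trans (⁻¹-∙-comm 1# 1#) (trans (cong -_ 1+1≡-1) (-‿involutive 1#))

  -1*-1≡1 : - 1# * - 1# ≡ 1#
  -1*-1≡1 = trans (-1*x≈-x (- 1#)) (-‿involutive 1#)

  private
    +-homo : ∀ x y → ⟦ x +₃ y ⟧₃ ≡ ⟦ x ⟧₃ + ⟦ y ⟧₃
    +-homo 0₃ y = sym (+-identityˡ _)
    +-homo 1₃ 0₃ = sym (+-identityʳ _)
    +-homo 1₃ 1₃ = sym 1+1≡-1
    +-homo 1₃ -1₃ = sym (-‿inverseʳ 1#)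
    +-homo -1₃ 0₃ = sym (+-identityʳ _)
    +-homo -1₃ 1₃ = sym (-‿inverseˡ 1#)
    +-homo -1₃ -1₃ = sym -1+-1≡1

    *-homo : ∀ x y → ⟦ x *₃ y ⟧₃ ≡ ⟦ x ⟧₃ * ⟦ y ⟧₃
    *-homo 0₃ y = sym (zeroˡ _)
    *-homo 1₃ y = sym (*-identityˡ _)
    *-homo -1₃ 0₃ = sym (zeroʳ _)
    *-homo -1₃ 1₃ = sym (*-identityʳ _)
    *-homo -1₃ -1₃ = sym -1*-1≡1

    -‿homo : ∀ x → ⟦ -₃ x ⟧₃ ≡ - ⟦ x ⟧₃
    -‿homo 0₃ = sym -0#≈0#
    -‿homo 1₃ = refl
    -‿homo -1₃ = sym (-‿involutive 1#)

    𝔽₃-morphism : 𝔽₃-rawRing -Raw-AlmostCommutative⟶ fromCommutativeRing commutativeRing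
    𝔽₃-morphism = record
      { ⟦_⟧ = ⟦_⟧₃ ; +-homo = +-homo ; *-homo = *-homo ; -‿homo = -‿homo ; 0-homo = refl ; 1-homo = refl }

    _≟₃_ : ∀ x y → Maybe (⟦ x ⟧₃ ≡ ⟦ y ⟧₃)
    0₃ ≟₃ 0₃ = just refl
    1₃ ≟₃ 1₃ = just refl
    -1₃ ≟₃ -1₃ = just refl
    _ ≟₃ _ = nothing

  open import Algebra.Solver.Ring 𝔽₃-rawRing (fromCommutativeRing commutativeRing) 𝔽₃-morphism _≟₃_ public
    using (Polynomial; solve; _:+_; _:*_; :-_; _:-_; _:=_; con)

  :0 :1 : ∀ {n} → Polynomial n
  :0 = con 0₃
  :1 = con 1₃

  x*x≡y*y⇒x≡y⊎x≡-y : ∀ {x y} → x * x ≡ y * y → x ≡ y ⊎ x ≡ - y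
  x*x≡y*y⇒x≡y⊎x≡-y {x} {y} xx≡yy with x*y≡0⇒x≡0⊎y≡0 (trans (difference-of-squares x y) (x≡y⇒x-y≡0 xx≡yy))
    where
    difference-of-squares : ∀ x y → (x - y) * (x + y) ≡ x * x - y * y
    difference-of-squares = solve 2 (λ x y → (x :- y) :* (x :+ y) := x :* x :- y :* y) refl
  ... | inj₁ x-y≡0 = inj₁ (x-y≡0⇒x≡y x-y≡0)
  ... | inj₂ x+y≡0 = inj₂ (trans (sym (x+y-y≡x x y)) (trans (cong (_- y) x+y≡0) (+-identityˡ (- y))))
    where
    x+y-y≡x : ∀ x y → x + y - y ≡ x
    x+y-y≡x = solve 2 (λ x y → x :+ y :- y := x) refl

  x≢-x : ∀ {x} → x ≢ 0# → x ≢ - x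
  x≢-x {x} x≢0 x≡-x = x≢0 (-x≡0⇒x≡0 (trans (sym (x+x≡-x x)) (trans (cong (x +_) x≡-x) (-‿inverseʳ x))))
    where
    x+x≡-x : ∀ x → x + x ≡ - x
    x+x≡-x = solve 1 (λ x → x :+ x := :- x) refl

  x*x≡1⇒x≡±1 : ∀ {x} → x * x ≡ 1# → x ≡ 1# ⊎ x ≡ - 1#
  x*x≡1⇒x≡±1 x²≡1 = x*x≡y*y⇒x≡y⊎x≡-y (trans x²≡1 (sym (*-identityˡ 1#)))

  -x*-x≡x*x : ∀ x → - x * - x ≡ x * x
  -x*-x≡x*x = solve 1 (λ x → :- x :* :- x := x :* x) refl

  HasSize-√ : ∀ {x} → x ≢ 0# → HasSize (λ t → t * t ≡ x * x) 2
  HasSize-√ {x} x≢0 = x ∷ - x ∷ [] , refl , ((x≢-x x≢0 ∷ []) ∷ [] ∷ []) ,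
    λ t → (λ { (here refl) → refl ; (there (here refl)) → -x*-x≡x*x x })
        , λ tt≡xx → [ here , there ∘ here ]′ (x*x≡y*y⇒x≡y⊎x≡-y tt≡xx)

module Lines (F : FiniteField) (3≡0 : FF.3# F ≡ FiniteField.0# F) where

  open import Data.Fin using (Fin; zero; suc)

  open FiniteField F
  open FF F
  open FieldProperties F
  open Characteristic3 F 3≡0

  pattern #0 = zero
  pattern #1 = suc zero
  pattern #2 = suc (suc zero)
  pattern #3 = suc (suc (suc zero))

  :2 :3 : ∀ {n} → Polynomial n
  :2 = :1 :+ :1
  :3 = :1 :+ :1 :+ :1

  :mkV : ∀ {n} → Polynomial n → Polynomial n → Polynomial n → Polynomial n → Fin 4 → Polynomial n
  :mkV x₀ x₁ x₂ x₃ #0 = x₀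
  :mkV x₀ x₁ x₂ x₃ #1 = x₁
  :mkV x₀ x₁ x₂ x₃ #2 = x₂
  :mkV x₀ x₁ x₂ x₃ #3 = x₃

  -- FF.M transcribed into the solver's syntax, so that the coordinates of x M(a,b,c,d) normalise.
  :M : ∀ {n} → Polynomial n → Polynomial n → Polynomial n → Polynomial n → Fin 4 → Fin 4 → Polynomial n
  :M a b c d #0 =
    :mkV (a :* a :* a) (a :* a :* c) (a :* c :* c) (c :* c :* c)
  :M a b c d #1 =
    :mkV (:3 :* a :* a :* b) (a :* a :* d :+ :2 :* a :* b :* c)
         (b :* c :* c :+ :2 :* a :* c :* d) (:3 :* c :* c :* d)
  :M a b c d #2 =
    :mkV (:3 :* a :* b :* b) (b :* b :* c :+ :2 :* a :* b :* d)
         (a :* d :* d :+ :2 :* b :* c :* d) (:3 :* c :* d :* d)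
  :M a b c d #3 =
    :mkV (b :* b :* b) (b :* b :* d) (b :* d :* d) (d :* d :* d)

  :act : ∀ {n} → Polynomial n → Polynomial n → Polynomial n → Polynomial n →
         (Fin 4 → Polynomial n) → Fin 4 → Polynomial n
  :act a b c d x j =
    x #0 :* :M a b c d #0 j :+ x #1 :* :M a b c d #1 j :+ x #2 :* :M a b c d #2 j :+ x #3 :* :M a b c d #3 j

  LineEquations : Carrier → V4 → Set
  LineEquations μ x = x #0 - x #2 ≡ 0# × x #1 - μ * x #3 ≡ 0#

  OnLine⇒LineEquations : ∀ {μ x} → OnLine μ x → LineEquations μ x
  OnLine⇒LineEquations {μ} {x} (s , t , x≡su+tv) =
    x≡y⇒x-y≡0 (trans (x≡su+tv #0) (sym (x≡su+tv #2))) ,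
    trans (cong₂ (λ x₁ x₃ → x₁ - μ * x₃) (x≡su+tv #1) (x≡su+tv #3)) (on-line s t μ)
    where
    on-line : ∀ s t μ → s * μ + t * 0# - μ * (s * 1# + t * 0#) ≡ 0#
    on-line = solve 3 (λ s t μ → s :* μ :+ t :* :0 :- μ :* (s :* :1 :+ t :* :0) := :0) refl

  LineEquations⇒OnLine : ∀ {μ x} → LineEquations μ x → OnLine μ x
  LineEquations⇒OnLine {μ} {x} (x₀-x₂≡0 , x₁-μx₃≡0) = x #3 , x #0 , λ
    { #0 → sym (coordinate₀ (x #3) (x #0))
    ; #1 → trans (x-y≡0⇒x≡y x₁-μx₃≡0) (coordinate₁ (x #3) (x #0) μ)
    ; #2 → trans (sym (x-y≡0⇒x≡y x₀-x₂≡0)) (sym (coordinate₀ (x #3) (x #0)))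
    ; #3 → sym (coordinate₃ (x #3) (x #0))
    }
    where
    coordinate₀ : ∀ s t → s * 0# + t * 1# ≡ t
    coordinate₀ = solve 2 (λ s t → s :* :0 :+ t :* :1 := t) refl
    coordinate₁ : ∀ s t μ → μ * s ≡ s * μ + t * 0#
    coordinate₁ = solve 3 (λ s t μ → μ :* s := s :* μ :+ t :* :0) refl
    coordinate₃ : ∀ s t → s * 1# + t * 0# ≡ s
    coordinate₃ = solve 2 (λ s t → s :* :1 :+ t :* :0 := s) refl

  u : Carrier → V4
  u μ = mkV 0# μ 0# 1#

  v : V4
  v = mkV 1# 0# 1# 0#

  u-on-line : ∀ μ → OnLine μ (u μ)
  u-on-line μ = LineEquations⇒OnLine (-‿inverseʳ 0# , equation μ)
    where
    equation : ∀ μ → μ - μ * 1# ≡ 0#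
    equation = solve 1 (λ μ → μ :- μ :* :1 := :0) refl

  v-on-line : ∀ μ → OnLine μ v
  v-on-line μ = LineEquations⇒OnLine (-‿inverseʳ 1# , equation μ)
    where
    equation : ∀ μ → 0# - μ * 0# ≡ 0#
    equation = solve 1 (λ μ → :0 :- μ :* :0 := :0) refl

  :u : ∀ {n} → Polynomial n → Fin 4 → Polynomial n
  :u μ = :mkV :0 μ :0 :1

  :v : ∀ {n} → Fin 4 → Polynomial n
  :v = :mkV :1 :0 :1 :0

  -- The equations x₀ = x₂ and x₁ = μ'x₃ of ℓ_μ' for the images of v and u under M(a,b,c,d),
  -- simplified using 3 = 0.
  record ImageEquations (μ μ' a b c d : Carrier) : Set where
    field
      det≢0 : a * d - b * c ≢ 0#
      v₀₂   : a * (a * a - c * c - d * d) + b * c * d ≡ 0#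
      v₁₃   : c * (a * a + b * b - μ' * c * c) - a * b * d ≡ 0#
      u₀₂   : b * (b * b - μ * c * c - d * d) + μ * a * c * d ≡ 0#
      u₁₃   : d * (μ * a * a + b * b - μ' * d * d) - μ * a * b * c ≡ 0#

  SameOrbit⇒ImageEquations : ∀ {μ μ'} → SameOrbit μ μ' → ∃₂ λ a b → ∃₂ λ c d → ImageEquations μ μ' a b c d
  SameOrbit⇒ImageEquations {μ} {μ'} (a , b , c , d , det≢0 , preserves) = a , b , c , d , record
    { det≢0 = det≢0
    ; v₀₂   = trans (sym (image-v₀₂ a b c d)) (proj₁ vM-on-ℓμ')
    ; v₁₃   = trans (sym (image-v₁₃ a b c d μ')) (proj₂ vM-on-ℓμ')
    ; u₀₂   = trans (sym (image-u₀₂ a b c d μ)) (proj₁ uM-on-ℓμ')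
    ; u₁₃   = trans (sym (image-u₁₃ a b c d μ μ')) (proj₂ uM-on-ℓμ')
    }
    where
    vM-on-ℓμ' = OnLine⇒LineEquations (proj₁ (preserves v) (v-on-line μ))
    uM-on-ℓμ' = OnLine⇒LineEquations (proj₁ (preserves (u μ)) (u-on-line μ))
    image-v₀₂ : ∀ a b c d → act a b c d v #0 - act a b c d v #2 ≡ a * (a * a - c * c - d * d) + b * c * d
    image-v₀₂ = solve 4 (λ a b c d →
      :act a b c d :v #0 :- :act a b c d :v #2 := a :* (a :* a :- c :* c :- d :* d) :+ b :* c :* d) refl
    image-v₁₃ : ∀ a b c d μ' → act a b c d v #1 - μ' * act a b c d v #3 ≡ c * (a * a + b * b - μ' * c * c) - a * b * d
    image-v₁₃ = solve 5 (λ a b c d μ' →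
      :act a b c d :v #1 :- μ' :* :act a b c d :v #3 := c :* (a :* a :+ b :* b :- μ' :* c :* c) :- a :* b :* d) refl
    image-u₀₂ : ∀ a b c d μ → act a b c d (u μ) #0 - act a b c d (u μ) #2 ≡ b * (b * b - μ * c * c - d * d) + μ * a * c * d
    image-u₀₂ = solve 5 (λ a b c d μ →
      :act a b c d (:u μ) #0 :- :act a b c d (:u μ) #2 := b :* (b :* b :- μ :* c :* c :- d :* d) :+ μ :* a :* c :* d) refl
    image-u₁₃ : ∀ a b c d μ μ' → act a b c d (u μ) #1 - μ' * act a b c d (u μ) #3 ≡ d * (μ * a * a + b * b - μ' * d * d) - μ * a * b * c
    image-u₁₃ = solve 6 (λ a b c d μ μ' →
      :act a b c d (:u μ) #1 :- μ' :* :act a b c d (:u μ) #3 := d :* (μ :* a :* a :+ b :* b :- μ' :* d :* d) :- μ :* a :* b :* c) refl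

module Orbits (F : FiniteField) (3≡0 : FF.3# F ≡ FiniteField.0# F) where

  open FiniteField F
  open FF F
  open FieldProperties F
  open Characteristic3 F 3≡0
  open Lines F 3≡0

  OrbitWitness : Carrier → Carrier → Set
  OrbitWitness μ μ' = ∃ λ d → d ≢ 0# × d ≢ 1# × d ≢ - 1# × IsSquare (1# - d * d)
    × (order % 4 ≡ 1 → d * d ≢ - 1#)
    × μ ≡ d * d * d * d × μ' ≡ d * d * d * d + d * d + 1#

  witness-r≢0 : ∀ {d r} → d ≢ 1# → d ≢ - 1# → r * r ≡ 1# - d * d → r ≢ 0#
  witness-r≢0 d≢1 d≢-1 r²≡1-d² refl =
    [ d≢1 , d≢-1 ]′ (x*x≡1⇒x≡±1 (sym (x-y≡0⇒x≡y (trans (sym r²≡1-d²) (zeroˡ 0#)))))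

  OrbitWitness-sym : ∀ {μ μ'} → OrbitWitness μ μ' → OrbitWitness μ' μ
  OrbitWitness-sym (d , d≢0 , d≢1 , d≢-1 , (r , r²≡1-d²) , d²≢-1 , refl , refl) =
    r , witness-r≢0 d≢1 d≢-1 r²≡1-d² , (λ r≡1 → d≢0 (d≡0 (cong square r≡1) (*-identityˡ 1#))) ,
    (λ r≡-1 → d≢0 (d≡0 (cong square r≡-1) -1*-1≡1)) , (d , d²≡1-r²) ,
    (λ q≡1 r²≡-1 → d²≢-1 q≡1 (trans d²≡1-r² (trans (cong (λ x → 1# - x) r²≡-1) 1--1≡-1))) ,
    sym (x-y≡0⇒x≡y (trans (r⁴ d r) ⟨ circle ⟩)) , x-y≡0⇒x≡y (trans (d⁴ d r) ⟨ circle ⟩)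
    where
    square : Carrier → Carrier
    square x = x * x
    circle : r * r - (1# - d * d) ≡ 0#
    circle = x≡y⇒x-y≡0 r²≡1-d²
    d²≡1-r² : d * d ≡ 1# - r * r
    d²≡1-r² = x-y≡0⇒x≡y (trans (swap d r) ⟨ circle ⟩)
      where
      swap : ∀ d r → d * d - (1# - r * r) ≡ 1# * (r * r - (1# - d * d))
      swap = solve 2 (λ d r → d :* d :- (:1 :- r :* r) := :1 :* (r :* r :- (:1 :- d :* d))) refl
    d≡0 : ∀ {x} → r * r ≡ x → x ≡ 1# → d ≡ 0#
    d≡0 refl r²≡1 = x*x≡0⇒x≡0 (trans d²≡1-r² (trans (cong (λ x → 1# - x) r²≡1) (-‿inverseʳ 1#)))
    1--1≡-1 : 1# - - 1# ≡ - 1#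
    1--1≡-1 = solve 0 (:1 :- :- :1 := :- :1) refl
    r⁴ : ∀ d r → r * r * r * r - (d * d * d * d + d * d + 1#) ≡ (r * r + 1# - d * d) * (r * r - (1# - d * d))
    r⁴ = solve 2 (λ d r → r :* r :* r :* r :- (d :* d :* d :* d :+ d :* d :+ :1) := (r :* r :+ :1 :- d :* d) :* (r :* r :- (:1 :- d :* d))) refl
    d⁴ : ∀ d r → d * d * d * d - (r * r * r * r + r * r + 1#) ≡ (- (r * r - 1# - d * d)) * (r * r - (1# - d * d))
    d⁴ = solve 2 (λ d r → d :* d :* d :* d :- (r :* r :* r :* r :+ r :* r :+ :1) := (:- (r :* r :- :1 :- d :* d)) :* (r :* r :- (:1 :- d :* d))) refl

  ImageEquations-scale : ∀ {μ μ' a b c d} k → k ≢ 0# → ImageEquations μ μ' a b c d →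
                         ImageEquations μ μ' (k * a) (k * b) (k * c) (k * d)
  ImageEquations-scale {μ} {μ'} {a} {b} {c} {d} k k≢0 E = record
    { det≢0 = λ det′≡0 → det≢0 (x*y≡0⇒y≡0 (x*y≢0 k≢0 k≢0) (trans (sym (scale-det k a b c d)) det′≡0))
    ; v₀₂   = trans (scale-v₀₂ k a b c d) ⟨ v₀₂ ⟩
    ; v₁₃   = trans (scale-v₁₃ k a b c d μ') ⟨ v₁₃ ⟩
    ; u₀₂   = trans (scale-u₀₂ k a b c d μ) ⟨ u₀₂ ⟩
    ; u₁₃   = trans (scale-u₁₃ k a b c d μ μ') ⟨ u₁₃ ⟩
    }
    where
    open ImageEquations E
    scale-det : ∀ k a b c d → k * a * (k * d) - k * b * (k * c) ≡ k * k * (a * d - b * c)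
    scale-det = solve 5 (λ k a b c d → k :* a :* (k :* d) :- k :* b :* (k :* c) := k :* k :* (a :* d :- b :* c)) refl
    scale-v₀₂ : ∀ k a b c d → k * a * (k * a * (k * a) - k * c * (k * c) - k * d * (k * d)) + k * b * (k * c) * (k * d) ≡ k * k * k * (a * (a * a - c * c - d * d) + b * c * d)
    scale-v₀₂ = solve 5 (λ k a b c d → k :* a :* (k :* a :* (k :* a) :- k :* c :* (k :* c) :- k :* d :* (k :* d)) :+ k :* b :* (k :* c) :* (k :* d) := k :* k :* k :* (a :* (a :* a :- c :* c :- d :* d) :+ b :* c :* d)) refl
    scale-v₁₃ : ∀ k a b c d μ' → k * c * (k * a * (k * a) + k * b * (k * b) - μ' * (k * c) * (k * c)) - k * a * (k * b) * (k * d) ≡ k * k * k * (c * (a * a + b * b - μ' * c * c) - a * b * d)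
    scale-v₁₃ = solve 6 (λ k a b c d μ' → k :* c :* (k :* a :* (k :* a) :+ k :* b :* (k :* b) :- μ' :* (k :* c) :* (k :* c)) :- k :* a :* (k :* b) :* (k :* d) := k :* k :* k :* (c :* (a :* a :+ b :* b :- μ' :* c :* c) :- a :* b :* d)) refl
    scale-u₀₂ : ∀ k a b c d μ → k * b * (k * b * (k * b) - μ * (k * c) * (k * c) - k * d * (k * d)) + μ * (k * a) * (k * c) * (k * d) ≡ k * k * k * (b * (b * b - μ * c * c - d * d) + μ * a * c * d)
    scale-u₀₂ = solve 6 (λ k a b c d μ → k :* b :* (k :* b :* (k :* b) :- μ :* (k :* c) :* (k :* c) :- k :* d :* (k :* d)) :+ μ :* (k :* a) :* (k :* c) :* (k :* d) := k :* k :* k :* (b :* (b :* b :- μ :* c :* c :- d :* d) :+ μ :* a :* c :* d)) refl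
    scale-u₁₃ : ∀ k a b c d μ μ' → k * d * (μ * (k * a) * (k * a) + k * b * (k * b) - μ' * (k * d) * (k * d)) - μ * (k * a) * (k * b) * (k * c) ≡ k * k * k * (d * (μ * a * a + b * b - μ' * d * d) - μ * a * b * c)
    scale-u₁₃ = solve 7 (λ k a b c d μ μ' → k :* d :* (μ :* (k :* a) :* (k :* a) :+ k :* b :* (k :* b) :- μ' :* (k :* d) :* (k :* d)) :- μ :* (k :* a) :* (k :* b) :* (k :* c) := k :* k :* k :* (d :* (μ :* a :* a :+ b :* b :- μ' :* d :* d) :- μ :* a :* b :* c)) refl

  module _ {μ μ' : Carrier} (μ≢0 : μ ≢ 0#) (μ≢1 : μ ≢ 1#) (μ≢μ' : μ ≢ μ') where

    c≢0 : ∀ {a b c d} → ImageEquations μ μ' a b c d → c ≢ 0#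
    c≢0 {a} {b} {d = d} E refl =
      μ≢μ' (x-y≡0⇒x≡y (x*y≡0⇒x≡0 d³≢0 (trans (μ-μ' a b d μ μ') (⟨ u₁₃ ⟩ ⊕ ⟨ a²-d²≡0 ⟩ ⊕ ⟨ b≡0 ⟩))))
      where
      open ImageEquations E
      det-a0 : ∀ b d → 0# * d - b * 0# ≡ 0#
      det-a0 = solve 2 (λ b d → :0 :* d :- b :* :0 := :0) refl
      det-d0 : ∀ a b → a * 0# - b * 0# ≡ 0#
      det-d0 = solve 2 (λ a b → a :* :0 :- b :* :0 := :0) refl
      abd : ∀ a b d μ' → a * b * d ≡ (- 1#) * (0# * (a * a + b * b - μ' * 0# * 0#) - a * b * d)
      abd = solve 4 (λ a b d μ' → a :* b :* d := (:- :1) :* (:0 :* (a :* a :+ b :* b :- μ' :* :0 :* :0) :- a :* b :* d)) refl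
      a²-d² : ∀ a b d → a * (a * a - d * d) ≡ 1# * (a * (a * a - 0# * 0# - d * d) + b * 0# * d)
      a²-d² = solve 3 (λ a b d → a :* (a :* a :- d :* d) := :1 :* (a :* (a :* a :- :0 :* :0 :- d :* d) :+ b :* :0 :* d)) refl
      μ-μ' : ∀ a b d μ μ' → (μ - μ') * (d * d * d) ≡ 1# * (d * (μ * a * a + b * b - μ' * d * d) - μ * a * b * 0#) + (- μ * d) * (a * a - d * d) + (- d * b) * b
      μ-μ' = solve 5 (λ a b d μ μ' → (μ :- μ') :* (d :* d :* d) := :1 :* (d :* (μ :* a :* a :+ b :* b :- μ' :* d :* d) :- μ :* a :* b :* :0) :+ (:- μ :* d) :* (a :* a :- d :* d) :+ (:- d :* b) :* b) refl
      a≢0 : a ≢ 0#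
      a≢0 refl = det≢0 (det-a0 b d)
      d≢0 : d ≢ 0#
      d≢0 refl = det≢0 (det-d0 a b)
      d³≢0 : d * d * d ≢ 0#
      d³≢0 = x*y≢0 (x*y≢0 d≢0 d≢0) d≢0
      b≡0 : b ≡ 0#
      b≡0 = x*y≡0⇒y≡0 a≢0 (x*y≡0⇒x≡0 d≢0 (trans (abd a b d μ') ⟨ v₁₃ ⟩))
      a²-d²≡0 : a * a - d * d ≡ 0#
      a²-d²≡0 = x*y≡0⇒y≡0 a≢0 (trans (a²-d² a b d) ⟨ v₀₂ ⟩)

    -- M(ka,kb,kc,kd) = k³M(a,b,c,d), so c can be normalised to 1.
    normalise : ∀ {a b c d} → ImageEquations μ μ' a b c d → ∃₂ λ a b → ∃ λ d → ImageEquations μ μ' a b 1# d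
    normalise {a} {b} {c} {d} E =
      c ⁻¹ * a , c ⁻¹ * b , c ⁻¹ * d ,
      subst (λ γ → ImageEquations μ μ' (c ⁻¹ * a) (c ⁻¹ * b) γ (c ⁻¹ * d)) c⁻¹c≡1
            (ImageEquations-scale (c ⁻¹) c⁻¹≢0 E)
      where
      c⁻¹c≡1 : c ⁻¹ * c ≡ 1#
      c⁻¹c≡1 = trans (*-comm (c ⁻¹) c) (x*x⁻¹≡1 (c≢0 E))
      c⁻¹≢0 : c ⁻¹ ≢ 0#
      c⁻¹≢0 c⁻¹≡0 = 0≢1 (trans (sym (trans (cong (_* c) c⁻¹≡0) (zeroˡ c))) c⁻¹c≡1)

    module Normalised {a b d} (E : ImageEquations μ μ' a b 1# d) where
      open ImageEquations E

      a≢0 : a ≢ 0#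
      a≢0 refl = μ≢μ' (sym (x-y≡0⇒x≡y (x*y≡0⇒y≡0 b≢0 (trans (a0-μ'-μ b d μ μ') (⟨ u₀₂ ⟩ ⊕ ⟨ d≡0 ⟩ ⊕ ⟨ v₁₃ ⟩)))))
        where
        bd : ∀ b d → b * d ≡ 1# * (0# * (0# * 0# - 1# * 1# - d * d) + b * 1# * d)
        bd = solve 2 (λ b d → b :* d := :1 :* (:0 :* (:0 :* :0 :- :1 :* :1 :- d :* d) :+ b :* :1 :* d)) refl
        det-b : ∀ b d → 0# * d - b * 1# ≡ (- 1#) * b
        det-b = solve 2 (λ b d → :0 :* d :- b :* :1 := (:- :1) :* b) refl
        a0-μ'-μ : ∀ b d μ μ' → b * (μ' - μ) ≡ 1# * (b * (b * b - μ * 1# * 1# - d * d) + μ * 0# * 1# * d) + (b * d) * d + (- b) * (1# * (0# * 0# + b * b - μ' * 1# * 1#) - 0# * b * d)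
        a0-μ'-μ = solve 4 (λ b d μ μ' → b :* (μ' :- μ) := :1 :* (b :* (b :* b :- μ :* :1 :* :1 :- d :* d) :+ μ :* :0 :* :1 :* d) :+ (b :* d) :* d :+ (:- b) :* (:1 :* (:0 :* :0 :+ b :* b :- μ' :* :1 :* :1) :- :0 :* b :* d)) refl
        b≢0 : b ≢ 0#
        b≢0 b≡0 = det≢0 (trans (det-b b d) ⟨ b≡0 ⟩)
        d≡0 : d ≡ 0#
        d≡0 = x*y≡0⇒y≡0 b≢0 (trans (bd b d) ⟨ v₀₂ ⟩)

      1-a²≢0 : 1# - a * a ≢ 0#
      1-a²≢0 1-a²≡0 = x*y≢0 (x*y≢0 μ≢0 a≢0) b≢0 (trans (μab a b d μ μ') (⟨ d≡0 ⟩ ⊕ ⟨ u₁₃ ⟩))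
        where
        d·det : ∀ a b d → d * (a * d - b * 1#) ≡ (- a) * (1# - a * a) + (- 1#) * (a * (a * a - 1# * 1# - d * d) + b * 1# * d)
        d·det = solve 3 (λ a b d → d :* (a :* d :- b :* :1) := (:- a) :* (:1 :- a :* a) :+ (:- :1) :* (a :* (a :* a :- :1 :* :1 :- d :* d) :+ b :* :1 :* d)) refl
        μab : ∀ a b d μ μ' → μ * a * b ≡ (μ * a * a + b * b - μ' * d * d) * d + (- 1#) * (d * (μ * a * a + b * b - μ' * d * d) - μ * a * b * 1#)
        μab = solve 5 (λ a b d μ μ' → μ :* a :* b := (μ :* a :* a :+ b :* b :- μ' :* d :* d) :* d :+ (:- :1) :* (d :* (μ :* a :* a :+ b :* b :- μ' :* d :* d) :- μ :* a :* b :* :1)) refl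
        det : ∀ a b d → a * d - b * 1# ≡ a * d + (- 1#) * b
        det = solve 3 (λ a b d → a :* d :- b :* :1 := a :* d :+ (:- :1) :* b) refl
        d≡0 : d ≡ 0#
        d≡0 = x*y≡0⇒x≡0 det≢0 (trans (d·det a b d) (⟨ 1-a²≡0 ⟩ ⊕ ⟨ v₀₂ ⟩))
        b≢0 : b ≢ 0#
        b≢0 b≡0 = det≢0 (trans (det a b d) (⟨ d≡0 ⟩ ⊕ ⟨ b≡0 ⟩))

      -- Eliminate μ, μ' using u₁₃, u₀₂, v₁₃ and then b using v₀₂; with s = 1 + d² − a² the
      -- result reads a²(s + d²)(s − 1)(s − d²)² = 0.
      quartic : a * a * ((1# - a * a - d * d) * (d * d - a * a) * (1# - a * a) * (1# - a * a)) ≡ 0#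
      quartic = trans (eliminate-b a b d) (⟨ μ-free ⟩ ⊕ ⟨ v₀₂ ⟩)
        where
        eliminate-μ : ∀ a b d μ μ' → a * b * (d * d - b * b) + b * b * d - d * d * d * (a * a + b * b) + a * b * d * d * d * d ≡ 1# * (d * (μ * a * a + b * b - μ' * d * d) - μ * a * b * 1#) + (- a) * (b * (b * b - μ * 1# * 1# - d * d) + μ * a * 1# * d) + (- (d * d * d)) * (1# * (a * a + b * b - μ' * 1# * 1#) - a * b * d)
        eliminate-μ = solve 5 (λ a b d μ μ' → a :* b :* (d :* d :- b :* b) :+ b :* b :* d :- d :* d :* d :* (a :* a :+ b :* b) :+ a :* b :* d :* d :* d :* d := :1 :* (d :* (μ :* a :* a :+ b :* b :- μ' :* d :* d) :- μ :* a :* b :* :1) :+ (:- a) :* (b :* (b :* b :- μ :* :1 :* :1 :- d :* d) :+ μ :* a :* :1 :* d) :+ (:- (d :* d :* d)) :* (:1 :* (a :* a :+ b :* b :- μ' :* :1 :* :1) :- a :* b :* d)) refl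
        μ-free : a * b * (d * d - b * b) + b * b * d - d * d * d * (a * a + b * b) + a * b * d * d * d * d ≡ 0#
        μ-free = trans (eliminate-μ a b d μ μ') (⟨ u₁₃ ⟩ ⊕ ⟨ u₀₂ ⟩ ⊕ ⟨ v₁₃ ⟩)
        eliminate-b : ∀ a b d → a * a * ((1# - a * a - d * d) * (d * d - a * a) * (1# - a * a) * (1# - a * a)) ≡ (d * d * d) * (a * b * (d * d - b * b) + b * b * d - d * d * d * (a * a + b * b) + a * b * d * d * d * d) + (a * (b * d * (b * d) + b * d * (a * (1# + d * d - a * a)) + a * a * ((1# + d * d - a * a) * (1# + d * d - a * a))) - (d * d - d * d * d * d) * (b * d + a * (1# + d * d - a * a)) - (a * d * d * d * d + a * d * d * d * d * d * d)) * (a * (a * a - 1# * 1# - d * d) + b * 1# * d)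
        eliminate-b = solve 3 (λ a b d → a :* a :* ((:1 :- a :* a :- d :* d) :* (d :* d :- a :* a) :* (:1 :- a :* a) :* (:1 :- a :* a)) := (d :* d :* d) :* (a :* b :* (d :* d :- b :* b) :+ b :* b :* d :- d :* d :* d :* (a :* a :+ b :* b) :+ a :* b :* d :* d :* d :* d) :+ (a :* (b :* d :* (b :* d) :+ b :* d :* (a :* (:1 :+ d :* d :- a :* a)) :+ a :* a :* ((:1 :+ d :* d :- a :* a) :* (:1 :+ d :* d :- a :* a))) :- (d :* d :- d :* d :* d :* d) :* (b :* d :+ a :* (:1 :+ d :* d :- a :* a)) :- (a :* d :* d :* d :* d :+ a :* d :* d :* d :* d :* d :* d)) :* (a :* (a :* a :- :1 :* :1 :- d :* d) :+ b :* :1 :* d)) refl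

      d²-a²≢0 : d * d - a * a ≢ 0#
      d²-a²≢0 d²-a²≡0 with x*x≡y*y⇒x≡y⊎x≡-y (x-y≡0⇒x≡y d²-a²≡0)
      ... | inj₁ d≡a = μ≢1 (sym (x-y≡0⇒x≡y (x*y≡0⇒x≡0 1-a²≢0 (trans (μ-equation a b d μ) (⟨ u₀₂ ⟩ ⊕ ⟨ b-1≡0 ⟩ ⊕ ⟨ x≡y⇒x-y≡0 d≡a ⟩)))))
        where
        b-equation : ∀ a b d → a * (b - 1#) ≡ 1# * (a * (a * a - 1# * 1# - d * d) + b * 1# * d) + a * (d * d - a * a) + (- b) * (d - a)
        b-equation = solve 3 (λ a b d → a :* (b :- :1) := :1 :* (a :* (a :* a :- :1 :* :1 :- d :* d) :+ b :* :1 :* d) :+ a :* (d :* d :- a :* a) :+ (:- b) :* (d :- a)) refl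
        μ-equation : ∀ a b d μ → (1# - μ) * (1# - a * a) ≡ 1# * (b * (b * b - μ * 1# * 1# - d * d) + μ * a * 1# * d) + (- (b * b + b + 1# - μ - d * d)) * (b - 1#) + (- (μ * a - d - a)) * (d - a)
        μ-equation = solve 4 (λ a b d μ → (:1 :- μ) :* (:1 :- a :* a) := :1 :* (b :* (b :* b :- μ :* :1 :* :1 :- d :* d) :+ μ :* a :* :1 :* d) :+ (:- (b :* b :+ b :+ :1 :- μ :- d :* d)) :* (b :- :1) :+ (:- (μ :* a :- d :- a)) :* (d :- a)) refl
        b-1≡0 : b - 1# ≡ 0#
        b-1≡0 = x*y≡0⇒y≡0 a≢0 (trans (b-equation a b d) (⟨ v₀₂ ⟩ ⊕ ⟨ d²-a²≡0 ⟩ ⊕ ⟨ x≡y⇒x-y≡0 d≡a ⟩))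
      ... | inj₂ d≡-a = μ≢1 (sym (x-y≡0⇒x≡y (x*y≡0⇒x≡0 1-a²≢0 (trans (μ-equation a b d μ) (⟨ u₀₂ ⟩ ⊕ ⟨ b+1≡0 ⟩ ⊕ ⟨ d+a≡0 ⟩)))))
        where
        b-equation : ∀ a b d → a * (b + 1#) ≡ (- 1#) * (a * (a * a - 1# * 1# - d * d) + b * 1# * d) + (- a) * (d * d - a * a) + b * (d + a)
        b-equation = solve 3 (λ a b d → a :* (b :+ :1) := (:- :1) :* (a :* (a :* a :- :1 :* :1 :- d :* d) :+ b :* :1 :* d) :+ (:- a) :* (d :* d :- a :* a) :+ b :* (d :+ a)) refl
        μ-equation : ∀ a b d μ → (1# - μ) * (1# - a * a) ≡ (- 1#) * (b * (b * b - μ * 1# * 1# - d * d) + μ * a * 1# * d) + (b * b - b + 1# - μ - d * d) * (b + 1#) + (d - a + μ * a) * (d + a)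
        μ-equation = solve 4 (λ a b d μ → (:1 :- μ) :* (:1 :- a :* a) := (:- :1) :* (b :* (b :* b :- μ :* :1 :* :1 :- d :* d) :+ μ :* a :* :1 :* d) :+ (b :* b :- b :+ :1 :- μ :- d :* d) :* (b :+ :1) :+ (d :- a :+ μ :* a) :* (d :+ a)) refl
        d+a≡0 : d + a ≡ 0#
        d+a≡0 = trans (cong (_+ a) d≡-a) (-‿inverseˡ a)
        b+1≡0 : b + 1# ≡ 0#
        b+1≡0 = x*y≡0⇒y≡0 a≢0 (trans (b-equation a b d) (⟨ v₀₂ ⟩ ⊕ ⟨ d²-a²≡0 ⟩ ⊕ ⟨ d+a≡0 ⟩))

      on-circle : 1# - a * a - d * d ≡ 0#
      on-circle = x*y≡0⇒x≡0 d²-a²≢0 (x*y≡0⇒x≡0 1-a²≢0 (x*y≡0⇒x≡0 1-a²≢0 (x*y≡0⇒y≡0 (x*y≢0 a≢0 a≢0) quartic)))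

      witness : OrbitWitness μ μ'
      witness =
        d , d≢0 , (λ d≡1 → d²≢1 (trans (cong square d≡1) (*-identityˡ 1#))) ,
        (λ d≡-1 → d²≢1 (trans (cong square d≡-1) -1*-1≡1)) ,
        (a , sym (x-y≡0⇒x≡y (trans (a²-via-circle a d) on-circle))) , (λ _ → d²≢-1) , μ≡d⁴ , μ'≡d⁴+d²+1
        where
        b-equation : ∀ a b d → d * (b + a * d) ≡ 1# * (a * (a * a - 1# * 1# - d * d) + b * 1# * d) + a * (1# - a * a - d * d)
        b-equation = solve 3 (λ a b d → d :* (b :+ a :* d) := :1 :* (a :* (a :* a :- :1 :* :1 :- d :* d) :+ b :* :1 :* d) :+ a :* (:1 :- a :* a :- d :* d)) refl
        μ-equation : ∀ a b d μ → a * d * (μ - d * d * d * d) ≡ (- 1#) * (b * (b * b - μ * 1# * 1# - d * d) + μ * a * 1# * d) + ((b + a * d) * (b + a * d) - d * d - μ) * (b + a * d) + (a * d * d * d) * (1# - a * a - d * d)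
        μ-equation = solve 4 (λ a b d μ → a :* d :* (μ :- d :* d :* d :* d) := (:- :1) :* (b :* (b :* b :- μ :* :1 :* :1 :- d :* d) :+ μ :* a :* :1 :* d) :+ ((b :+ a :* d) :* (b :+ a :* d) :- d :* d :- μ) :* (b :+ a :* d) :+ (a :* d :* d :* d) :* (:1 :- a :* a :- d :* d)) refl
        μ'-equation : ∀ a b d μ' → μ' - (d * d * d * d + d * d + 1#) ≡ (- 1#) * (1# * (a * a + b * b - μ' * 1# * 1#) - a * b * d) + (b + a * d) * (b + a * d) + (d * d - 1#) * (1# - a * a - d * d)
        μ'-equation = solve 4 (λ a b d μ' → μ' :- (d :* d :* d :* d :+ d :* d :+ :1) := (:- :1) :* (:1 :* (a :* a :+ b :* b :- μ' :* :1 :* :1) :- a :* b :* d) :+ (b :+ a :* d) :* (b :+ a :* d) :+ (d :* d :- :1) :* (:1 :- a :* a :- d :* d)) refl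
        1-a² : ∀ a d → 1# - a * a ≡ 1# * (1# - a * a - d * d) + d * d
        1-a² = solve 2 (λ a d → :1 :- a :* a := :1 :* (:1 :- a :* a :- d :* d) :+ d :* d) refl
        a²-via-circle : ∀ a d → 1# - d * d - a * a ≡ 1# - a * a - d * d
        a²-via-circle = solve 2 (λ a d → :1 :- d :* d :- a :* a := :1 :- a :* a :- d :* d) refl
        d≢0 : d ≢ 0#
        d≢0 d≡0 = 1-a²≢0 (trans (1-a² a d) (⟨ on-circle ⟩ ⊕ ⟨ d≡0 ⟩))
        b+ad≡0 : b + a * d ≡ 0#
        b+ad≡0 = x*y≡0⇒y≡0 d≢0 (trans (b-equation a b d) (⟨ v₀₂ ⟩ ⊕ ⟨ on-circle ⟩))
        μ≡d⁴ : μ ≡ d * d * d * d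
        μ≡d⁴ = x-y≡0⇒x≡y (x*y≡0⇒y≡0 (x*y≢0 a≢0 d≢0) (trans (μ-equation a b d μ) (⟨ u₀₂ ⟩ ⊕ ⟨ b+ad≡0 ⟩ ⊕ ⟨ on-circle ⟩)))
        μ'≡d⁴+d²+1 : μ' ≡ d * d * d * d + d * d + 1#
        μ'≡d⁴+d²+1 = x-y≡0⇒x≡y (trans (μ'-equation a b d μ') (⟨ v₁₃ ⟩ ⊕ ⟨ b+ad≡0 ⟩ ⊕ ⟨ on-circle ⟩))
        square : Carrier → Carrier
        square x = x * x
        d⁴≡[d²]² : ∀ d → d * d * d * d ≡ d * d * (d * d)
        d⁴≡[d²]² = solve 1 (λ d → d :* d :* d :* d := d :* d :* (d :* d)) refl
        μ≡[d²]² : μ ≡ square (d * d)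
        μ≡[d²]² = trans μ≡d⁴ (d⁴≡[d²]² d)
        d²≢1 : d * d ≢ 1#
        d²≢1 d²≡1 = μ≢1 (trans μ≡[d²]² (trans (cong square d²≡1) (*-identityˡ 1#)))
        d²≢-1 : d * d ≢ - 1#
        d²≢-1 d²≡-1 = μ≢1 (trans μ≡[d²]² (trans (cong square d²≡-1) -1*-1≡1))

  SameOrbit⇒OrbitWitness : ∀ {μ μ'} → Adm μ → μ ≢ μ' → SameOrbit μ μ' → OrbitWitness μ μ'
  SameOrbit⇒OrbitWitness (μ≢0 , μ≢1) μ≢μ' orbit =
    let (_ , _ , _ , _ , E) = SameOrbit⇒ImageEquations orbit
        (_ , _ , _ , E₁)    = normalise μ≢0 μ≢1 μ≢μ' E
    in Normalised.witness μ≢0 μ≢1 μ≢μ' E₁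

  OrbitWitness⇒SameOrbit : ∀ {μ μ'} → OrbitWitness μ μ' → SameOrbit μ μ'
  OrbitWitness⇒SameOrbit (d , d≢0 , d≢1 , d≢-1 , (r , r²≡1-d²) , _ , refl , refl) =
    r , - (r * d) , 1# , d , det≢0 , λ x → maps-into x , maps-back x
    where
    circle : r * r - (1# - d * d) ≡ 0#
    circle = x≡y⇒x-y≡0 r²≡1-d²

    r≢0 : r ≢ 0#
    r≢0 = witness-r≢0 d≢1 d≢-1 r²≡1-d²

    det≢0 : r * d - - (r * d) * 1# ≢ 0#
    det≢0 det≡0 = x*y≢0 r≢0 d≢0 (-x≡0⇒x≡0 (trans (sym (det r d)) det≡0))
      where
      det : ∀ r d → r * d - - (r * d) * 1# ≡ - (r * d)
      det = solve 2 (λ r d → r :* d :- :- (r :* d) :* :1 := :- (r :* d)) refl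

    maps-into : ∀ x → OnLine (d * d * d * d) x → OnLine (d * d * d * d + d * d + 1#) (act r (- (r * d)) 1# d x)
    maps-into x on-ℓμ = LineEquations⇒OnLine
      ( trans (image₀₂ r d (x #0) (x #1) (x #2) (x #3)) (⟨ x₀₂ ⟩ ⊕ ⟨ x₁₃ ⟩ ⊕ ⟨ circle ⟩)
      , trans (image₁₃ r d (x #0) (x #1) (x #2) (x #3)) (⟨ x₀₂ ⟩ ⊕ ⟨ x₁₃ ⟩ ⊕ ⟨ circle ⟩))
      where
      x₀₂ = proj₁ (OnLine⇒LineEquations on-ℓμ)
      x₁₃ = proj₂ (OnLine⇒LineEquations on-ℓμ)
      image₀₂ : ∀ r d x₀ x₁ x₂ x₃ → let y = act r (- (r * d)) 1# d (mkV x₀ x₁ x₂ x₃) in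
                y #0 - y #2 ≡ (- (r * d * d)) * (x₀ - x₂) + (- (r * d)) * (x₁ - d * d * d * d * x₃) + (r * x₀ - r * d * d * d * x₃) * (r * r - (1# - d * d))
      image₀₂ = solve 6 (λ r d x₀ x₁ x₂ x₃ → let y = :act r (:- (r :* d)) :1 d (:mkV x₀ x₁ x₂ x₃) in
                y #0 :- y #2 := (:- (r :* d :* d)) :* (x₀ :- x₂) :+ (:- (r :* d)) :* (x₁ :- d :* d :* d :* d :* x₃) :+ (r :* x₀ :- r :* d :* d :* d :* x₃) :* (r :* r :- (:1 :- d :* d))) refl
      image₁₃ : ∀ r d x₀ x₁ x₂ x₃ → let y = act r (- (r * d)) 1# d (mkV x₀ x₁ x₂ x₃) in
                y #1 - (d * d * d * d + d * d + 1#) * y #3 ≡ (d * d - d * d * d * d) * (x₀ - x₂) + (d * d * d - d) * (x₁ - d * d * d * d * x₃) + (x₀ - d * x₁ - d * d * x₂ + d * d * d * x₃) * (r * r - (1# - d * d))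
      image₁₃ = solve 6 (λ r d x₀ x₁ x₂ x₃ → let y = :act r (:- (r :* d)) :1 d (:mkV x₀ x₁ x₂ x₃) in
                y #1 :- (d :* d :* d :* d :+ d :* d :+ :1) :* y #3 := (d :* d :- d :* d :* d :* d) :* (x₀ :- x₂) :+ (d :* d :* d :- d) :* (x₁ :- d :* d :* d :* d :* x₃) :+ (x₀ :- d :* x₁ :- d :* d :* x₂ :+ d :* d :* d :* x₃) :* (r :* r :- (:1 :- d :* d))) refl

    maps-back : ∀ x → OnLine (d * d * d * d + d * d + 1#) (act r (- (r * d)) 1# d x) → OnLine (d * d * d * d) x
    maps-back x on-ℓμ' = LineEquations⇒OnLine
      ( x*y≡0⇒y≡0 r³d³≢0 (trans (preimage₀₂ r d (x #0) (x #1) (x #2) (x #3)) (⟨ y₀₂ ⟩ ⊕ ⟨ y₁₃ ⟩ ⊕ ⟨ circle ⟩))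
      , x*y≡0⇒y≡0 r³d³≢0 (trans (preimage₁₃ r d (x #0) (x #1) (x #2) (x #3)) (⟨ y₀₂ ⟩ ⊕ ⟨ y₁₃ ⟩ ⊕ ⟨ circle ⟩)))
      where
      y₀₂ = proj₁ (OnLine⇒LineEquations on-ℓμ')
      y₁₃ = proj₂ (OnLine⇒LineEquations on-ℓμ')
      r³d³≢0 : r * r * r * d * d * d ≢ 0#
      r³d³≢0 = x*y≢0 (x*y≢0 (x*y≢0 (x*y≢0 (x*y≢0 r≢0 r≢0) r≢0) d≢0) d≢0) d≢0
      preimage₀₂ : ∀ r d x₀ x₁ x₂ x₃ → let y = act r (- (r * d)) 1# d (mkV x₀ x₁ x₂ x₃) in
                   r * r * r * d * d * d * (x₀ - x₂) ≡ (- (d * d * d - d)) * (y #0 - y #2) + (- (r * d)) * (y #1 - (d * d * d * d + d * d + 1#) * y #3) + (- (r * d * d * x₁) + r * d * d * d * x₂ - r * d * d * d * x₀ - r * d * d * d * d * x₃ - r * d * d * d * d * d * d * x₃) * (r * r - (1# - d * d))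
      preimage₀₂ = solve 6 (λ r d x₀ x₁ x₂ x₃ → let y = :act r (:- (r :* d)) :1 d (:mkV x₀ x₁ x₂ x₃) in
                   r :* r :* r :* d :* d :* d :* (x₀ :- x₂) := (:- (d :* d :* d :- d)) :* (y #0 :- y #2) :+ (:- (r :* d)) :* (y #1 :- (d :* d :* d :* d :+ d :* d :+ :1) :* y #3) :+ (:- (r :* d :* d :* x₁) :+ r :* d :* d :* d :* x₂ :- r :* d :* d :* d :* x₀ :- r :* d :* d :* d :* d :* x₃ :- r :* d :* d :* d :* d :* d :* d :* x₃) :* (r :* r :- (:1 :- d :* d))) refl
      preimage₁₃ : ∀ r d x₀ x₁ x₂ x₃ → let y = act r (- (r * d)) 1# d (mkV x₀ x₁ x₂ x₃) in
                   r * r * r * d * d * d * (x₁ - d * d * d * d * x₃) ≡ (d * d - d * d * d * d) * (y #0 - y #2) + (r * d * d) * (y #1 - (d * d * d * d + d * d + 1#) * y #3) + (r * d * d * x₀ - r * d * d * d * x₁ + r * d * d * d * d * x₂ + r * d * d * d * d * x₀ + r * d * d * d * d * d * d * d * x₃) * (r * r - (1# - d * d))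
      preimage₁₃ = solve 6 (λ r d x₀ x₁ x₂ x₃ → let y = :act r (:- (r :* d)) :1 d (:mkV x₀ x₁ x₂ x₃) in
                   r :* r :* r :* d :* d :* d :* (x₁ :- d :* d :* d :* d :* x₃) := (d :* d :- d :* d :* d :* d) :* (y #0 :- y #2) :+ (r :* d :* d) :* (y #1 :- (d :* d :* d :* d :+ d :* d :+ :1) :* y #3) :+ (r :* d :* d :* x₀ :- r :* d :* d :* d :* x₁ :+ r :* d :* d :* d :* d :* x₂ :+ r :* d :* d :* d :* d :* x₀ :+ r :* d :* d :* d :* d :* d :* d :* d :* x₃) :* (r :* r :- (:1 :- d :* d))) refl

module Circle (F : FiniteField) (3≡0 : FF.3# F ≡ FiniteField.0# F) where

  open FiniteField F
  open FF F
  open FieldProperties F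
  open Characteristic3 F 3≡0
  open Counting

  open import Data.List.Membership.DecPropositional _≟ₚ_ using (_∈?_)

  Circle : Pred Point _
  Circle (u , v) = u * u + v * v - 1# ≡ 0#

  Punctured : Pred Point _
  Punctured = Circle ∖ (_≡ (- 1# , 0#))

  Punctured? : Decidable Punctured
  Punctured? (u , v) = (u * u + v * v - 1# ≟ 0#) ×-dec ¬? ((u , v) ≟ₚ (- 1# , 0#))

  -- The slope of the line through (−1, 0) and (u, v); it identifies Punctured with {t | t² ≠ −1}.
  stereographic : Point → Carrier
  stereographic (u , v) = v * (1# + u) ⁻¹

  point : Carrier → Point
  point t = (1# - t * t) * (1# + t * t) ⁻¹ , - (t * (1# + t * t) ⁻¹)

  1+u≢0 : ∀ {u v} → Punctured (u , v) → 1# + u ≢ 0#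
  1+u≢0 {u} {v} (on-circle , ≢-1,0) 1+u≡0 = ≢-1,0 (cong₂ _,_ u≡-1 (x*x≡0⇒x≡0 (trans (v² u v) (⟨ on-circle ⟩ ⊕ ⟨ 1+u≡0 ⟩))))
    where
    v² : ∀ u v → v * v ≡ 1# * (u * u + v * v - 1#) + (1# - u) * (1# + u)
    v² = solve 2 (λ u v → v :* v := :1 :* (u :* u :+ v :* v :- :1) :+ (:1 :- u) :* (:1 :+ u)) refl
    u≡-1 : u ≡ - 1#
    u≡-1 = inverseʳ-unique 1# u 1+u≡0

  1+t²≢0 : ∀ {t} → t * t ≢ - 1# → 1# + t * t ≢ 0#
  1+t²≢0 t²≢-1 1+t²≡0 = t²≢-1 (inverseʳ-unique 1# _ 1+t²≡0)

  stereographic-image : ∀ {p} → Punctured p → stereographic p * stereographic p ≢ - 1#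
  stereographic-image {u , v} p-punctured t²≡-1 =
    1+u≢0 p-punctured (trans (identity u v w) (⟨ proj₁ p-punctured ⟩ ⊕ ⟨ t²+1≡0 ⟩ ⊕ ⟨ x≡y⇒x-y≡0 (x*x⁻¹≡1 (1+u≢0 p-punctured)) ⟩))
    where
    w = (1# + u) ⁻¹
    identity : ∀ u v w → 1# + u ≡ 1# * (u * u + v * v - 1#) + (- ((1# + u) * (1# + u))) * (v * w * (v * w) + 1#) + (v * v * ((1# + u) * w + 1#)) * ((1# + u) * w - 1#)
    identity = solve 3 (λ u v w → :1 :+ u := :1 :* (u :* u :+ v :* v :- :1) :+ (:- ((:1 :+ u) :* (:1 :+ u))) :* (v :* w :* (v :* w) :+ :1) :+ (v :* v :* ((:1 :+ u) :* w :+ :1)) :* ((:1 :+ u) :* w :- :1)) refl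
    t²+1≡0 : v * w * (v * w) + 1# ≡ 0#
    t²+1≡0 = trans (cong (_+ 1#) t²≡-1) (-‿inverseˡ 1#)

  module _ {t : Carrier} (t²≢-1 : t * t ≢ - 1#) where

    private
      s = (1# + t * t) ⁻¹
      [1+t²]s-1≡0 : (1# + t * t) * s - 1# ≡ 0#
      [1+t²]s-1≡0 = x≡y⇒x-y≡0 (x*x⁻¹≡1 (1+t²≢0 t²≢-1))

    point-punctured : Punctured (point t)
    point-punctured = trans (on-circle t s) ⟨ [1+t²]s-1≡0 ⟩ , λ p≡-1,0 → 0≢1 (sym (trans (one t s) (⟨ [1+t²]s-1≡0 ⟩ ⊕ ⟨ u+1≡0 (cong proj₁ p≡-1,0) ⟩)))
      where
      on-circle : ∀ t s → (1# - t * t) * s * ((1# - t * t) * s) + - (t * s) * - (t * s) - 1# ≡ (s * (1# + t * t) + 1#) * ((1# + t * t) * s - 1#)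
      on-circle = solve 2 (λ t s → (:1 :- t :* t) :* s :* ((:1 :- t :* t) :* s) :+ :- (t :* s) :* :- (t :* s) :- :1 := (s :* (:1 :+ t :* t) :+ :1) :* ((:1 :+ t :* t) :* s :- :1)) refl
      one : ∀ t s → 1# ≡ (1# - t * t) * ((1# + t * t) * s - 1#) + (- (1# + t * t)) * ((1# - t * t) * s + 1#)
      one = solve 2 (λ t s → :1 := (:1 :- t :* t) :* ((:1 :+ t :* t) :* s :- :1) :+ (:- (:1 :+ t :* t)) :* ((:1 :- t :* t) :* s :+ :1)) refl
      u+1≡0 : ∀ {u} → u ≡ - 1# → u + 1# ≡ 0#
      u+1≡0 refl = -‿inverseˡ 1#

    stereographic-point : stereographic (point t) ≡ t
    stereographic-point = x-y≡0⇒x≡y (trans (identity t s w) (⟨ v-t[1+u]≡0 ⟩ ⊕ ⟨ x≡y⇒x-y≡0 (x*x⁻¹≡1 (1+u≢0 point-punctured)) ⟩))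
      where
      w = (1# + (1# - t * t) * s) ⁻¹
      identity : ∀ t s w → - (t * s) * w - t ≡ w * (- (t * s) - t * (1# + (1# - t * t) * s)) + t * ((1# + (1# - t * t) * s) * w - 1#)
      identity = solve 3 (λ t s w → :- (t :* s) :* w :- t := w :* (:- (t :* s) :- t :* (:1 :+ (:1 :- t :* t) :* s)) :+ t :* ((:1 :+ (:1 :- t :* t) :* s) :* w :- :1)) refl
      v-t[1+u] : ∀ t s → - (t * s) - t * (1# + (1# - t * t) * s) ≡ t * ((1# + t * t) * s - 1#)
      v-t[1+u] = solve 2 (λ t s → :- (t :* s) :- t :* (:1 :+ (:1 :- t :* t) :* s) := t :* ((:1 :+ t :* t) :* s :- :1)) refl
      v-t[1+u]≡0 : - (t * s) - t * (1# + (1# - t * t) * s) ≡ 0#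
      v-t[1+u]≡0 = trans (v-t[1+u] t s) ⟨ [1+t²]s-1≡0 ⟩

    stereographic-injective : ∀ {p} → Punctured p → stereographic p ≡ t → p ≡ point t
    stereographic-injective {u , v} p-punctured ψp≡t = cong₂ _,_ (x-y≡0⇒x≡y u≡) (x-y≡0⇒x≡y v≡)
      where
      w = (1# + u) ⁻¹
      [1+u]w-1≡0 : (1# + u) * w - 1# ≡ 0#
      [1+u]w-1≡0 = x≡y⇒x-y≡0 (x*x⁻¹≡1 (1+u≢0 p-punctured))
      v-equation : ∀ u v t w → v - t * (1# + u) ≡ (- v) * ((1# + u) * w - 1#) + (1# + u) * (v * w - t)
      v-equation = solve 4 (λ u v t w → v :- t :* (:1 :+ u) := (:- v) :* ((:1 :+ u) :* w :- :1) :+ (:1 :+ u) :* (v :* w :- t)) refl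
      v≡t[1+u] : v - t * (1# + u) ≡ 0#
      v≡t[1+u] = trans (v-equation u v t w) (⟨ [1+u]w-1≡0 ⟩ ⊕ ⟨ x≡y⇒x-y≡0 ψp≡t ⟩)
      u-equation : ∀ u v t → (1# + u) * (u - 1# + t * t * (1# + u)) ≡ 1# * (u * u + v * v - 1#) + (- (v + t * (1# + u))) * (v - t * (1# + u))
      u-equation = solve 3 (λ u v t → (:1 :+ u) :* (u :- :1 :+ t :* t :* (:1 :+ u)) := :1 :* (u :* u :+ v :* v :- :1) :+ (:- (v :+ t :* (:1 :+ u))) :* (v :- t :* (:1 :+ u))) refl
      linear : u - 1# + t * t * (1# + u) ≡ 0#
      linear = x*y≡0⇒y≡0 (1+u≢0 p-punctured) (trans (u-equation u v t) (⟨ proj₁ p-punctured ⟩ ⊕ ⟨ v≡t[1+u] ⟩))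
      u-solution : ∀ u t s → u - (1# - t * t) * s ≡ (- u) * ((1# + t * t) * s - 1#) + s * (u - 1# + t * t * (1# + u))
      u-solution = solve 3 (λ u t s → u :- (:1 :- t :* t) :* s := (:- u) :* ((:1 :+ t :* t) :* s :- :1) :+ s :* (u :- :1 :+ t :* t :* (:1 :+ u))) refl
      u≡ : u - (1# - t * t) * s ≡ 0#
      u≡ = trans (u-solution u t s) (⟨ [1+t²]s-1≡0 ⟩ ⊕ ⟨ linear ⟩)
      v-solution : ∀ u v t s → v - - (t * s) ≡ (- t) * ((1# + t * t) * s - 1#) + 1# * (v - t * (1# + u)) + t * (u - (1# - t * t) * s)
      v-solution = solve 4 (λ u v t s → v :- :- (t :* s) := (:- t) :* ((:1 :+ t :* t) :* s :- :1) :+ :1 :* (v :- t :* (:1 :+ u)) :+ t :* (u :- (:1 :- t :* t) :* s)) refl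
      v≡ : v - - (t * s) ≡ 0#
      v≡ = trans (v-solution u v t s) (⟨ [1+t²]s-1≡0 ⟩ ⊕ ⟨ v≡t[1+u] ⟩ ⊕ ⟨ u≡ ⟩)

  axes : List Point
  axes = (1# , 0#) ∷ (0# , 1#) ∷ (0# , - 1#) ∷ []

  Axes : Pred Point _
  Axes = _∈ axes

  Imaginary : Pred Point _
  Imaginary (u , _) = u * u ≡ - 1#

  Generic : Pred Point _
  Generic (u , v) = Circle (u , v) × u ≢ 0# × v ≢ 0# × u * u ≢ - 1#

  private
    on-axis : ∀ {u v} → Axes (u , v) → u ≡ 0# ⊎ v ≡ 0#
    on-axis (here refl) = inj₂ refl
    on-axis (there (here refl)) = inj₁ refl
    on-axis (there (there (here refl))) = inj₁ refl

  module _ {n : ℕ} (roots : HasSize (λ t → t * t ≡ - 1#) n) where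

    Punctured-size : HasSize Punctured (order ∸ n)
    Punctured-size with HasSize-filter HasSize-Point (λ _ → tt) Punctured?
    ... | m , P-size = subst (HasSize Punctured) (trans m≡1*[q-n] (ℕ.*-identityˡ _)) P-size
      where
      non-roots : HasSize (λ t → ⊤ × t * t ≢ - 1#) (order ∸ n)
      non-roots = HasSize-∖ (λ t → t * t ≟ - 1#) HasSize-Carrier (HasSize-cong (tt ,_) proj₂ roots)
      fibre : ∀ {t} → ⊤ × t * t ≢ - 1# → HasSize (λ p → Punctured p × stereographic p ≡ t) 1
      fibre {t} (_ , t²≢-1) = point t ∷ [] , refl , [] ∷ [] , λ p →
        (λ { (here refl) → point-punctured t²≢-1 , stereographic-point t²≢-1 }) ,
        λ (p-punctured , ψp≡t) → here (stereographic-injective t²≢-1 p-punctured ψp≡t)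
      m≡1*[q-n] : m ≡ 1 *ℕ (order ∸ n)
      m≡1*[q-n] = HasSize-fibres _≟_ stereographic P-size non-roots (λ p-punctured → tt , stereographic-image p-punctured) fibre

    private
      axes-size : HasSize (Punctured ∩ Axes) 3
      axes-size = HasSize-cong (λ p∈ → axis-punctured p∈ , p∈) proj₂ (HasSize-∈ axes-unique)
        where
        axes-unique : Unique axes
        axes-unique = ((λ e → 1≢0 (cong proj₁ e)) ∷ (λ e → 1≢0 (cong proj₁ e)) ∷ []) ∷ ((λ e → x≢-x 1≢0 (cong proj₂ e)) ∷ []) ∷ [] ∷ []
        circle₁₀ : 1# * 1# + 0# * 0# - 1# ≡ 0#
        circle₁₀ = solve 0 (:1 :* :1 :+ :0 :* :0 :- :1 := :0) refl
        circle₀₁ : 0# * 0# + 1# * 1# - 1# ≡ 0#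
        circle₀₁ = solve 0 (:0 :* :0 :+ :1 :* :1 :- :1 := :0) refl
        circle₀₋₁ : 0# * 0# + - 1# * - 1# - 1# ≡ 0#
        circle₀₋₁ = solve 0 (:0 :* :0 :+ :- :1 :* :- :1 :- :1 := :0) refl
        axis-punctured : ∀ {p} → Axes p → Punctured p
        axis-punctured (here refl) = circle₁₀ , λ e → x≢-x 1≢0 (cong proj₁ e)
        axis-punctured (there (here refl)) = circle₀₁ , λ e → -1≢0 (sym (cong proj₁ e))
        axis-punctured (there (there (here refl))) = circle₀₋₁ , λ e → -1≢0 (sym (cong proj₁ e))

      imaginary-size : HasSize ((Punctured ∖ Axes) ∩ Imaginary) (n *ℕ n)
      imaginary-size = HasSize-cong to from (HasSize-× roots roots)
        where
        sum : ∀ u v → u * u + v * v - 1# ≡ 1# * (u * u + 1#) + 1# * (v * v + 1#)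
        sum = solve 2 (λ u v → u :* u :+ v :* v :- :1 := :1 :* (u :* u :+ :1) :+ :1 :* (v :* v :+ :1)) refl
        difference : ∀ u v → v * v + 1# ≡ 1# * (u * u + v * v - 1#) + (- 1#) * (u * u + 1#)
        difference = solve 2 (λ u v → v :* v :+ :1 := :1 :* (u :* u :+ v :* v :- :1) :+ (:- :1) :* (u :* u :+ :1)) refl
        x²≢0 : ∀ {x} → x * x ≡ - 1# → x ≢ 0#
        x²≢0 x²≡-1 refl = -1≢0 (trans (sym x²≡-1) (zeroˡ 0#))
        +1≡0 : ∀ {x} → x ≡ - 1# → x + 1# ≡ 0#
        +1≡0 refl = -‿inverseˡ 1#
        to : ∀ {p} → proj₁ p * proj₁ p ≡ - 1# × proj₂ p * proj₂ p ≡ - 1# → ((Punctured ∖ Axes) ∩ Imaginary) p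
        to {u , v} (u²≡-1 , v²≡-1) =
          ((trans (sum u v) (⟨ +1≡0 u²≡-1 ⟩ ⊕ ⟨ +1≡0 v²≡-1 ⟩) , λ e → x²≢0 v²≡-1 (cong proj₂ e)) ,
           λ p∈ → [ x²≢0 u²≡-1 , x²≢0 v²≡-1 ]′ (on-axis p∈)) ,
          u²≡-1
        from : ∀ {p} → ((Punctured ∖ Axes) ∩ Imaginary) p → proj₁ p * proj₁ p ≡ - 1# × proj₂ p * proj₂ p ≡ - 1#
        from {u , v} (((on-circle , _) , _) , u²≡-1) =
          u²≡-1 , inverseˡ-unique (v * v) 1# (trans (difference u v) (⟨ on-circle ⟩ ⊕ ⟨ +1≡0 u²≡-1 ⟩))

    Generic-size : HasSize Generic (order ∸ n ∸ 3 ∸ n *ℕ n)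
    Generic-size = HasSize-cong to from
      (HasSize-∖ (λ p → proj₁ p * proj₁ p ≟ - 1#) (HasSize-∖ (_∈? axes) Punctured-size axes-size) imaginary-size)
      where
      circle₀ : ∀ x → x * x - 1# ≡ 1# * (0# * 0# + x * x - 1#)
      circle₀ = solve 1 (λ x → x :* x :- :1 := :1 :* (:0 :* :0 :+ x :* x :- :1)) refl
      circle₀′ : ∀ x → x * x - 1# ≡ 1# * (x * x + 0# * 0# - 1#)
      circle₀′ = solve 1 (λ x → x :* x :- :1 := :1 :* (x :* x :+ :0 :* :0 :- :1)) refl
      to : ∀ {p} → ((Punctured ∖ Axes) ∖ Imaginary) p → Generic p
      to {u , v} (((on-circle , ≢-1,0) , ∉axes) , ¬imaginary) = on-circle , u≢0 , v≢0 , ¬imaginary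
        where
        u≢0 : u ≢ 0#
        u≢0 refl with x*x≡1⇒x≡±1 (x-y≡0⇒x≡y (trans (circle₀ v) ⟨ on-circle ⟩))
        ... | inj₁ refl = ∉axes (there (here refl))
        ... | inj₂ refl = ∉axes (there (there (here refl)))
        v≢0 : v ≢ 0#
        v≢0 refl with x*x≡1⇒x≡±1 (x-y≡0⇒x≡y (trans (circle₀′ u) ⟨ on-circle ⟩))
        ... | inj₁ refl = ∉axes (here refl)
        ... | inj₂ refl = ≢-1,0 refl
      from : ∀ {p} → Generic p → ((Punctured ∖ Axes) ∖ Imaginary) p
      from {u , v} (on-circle , u≢0 , v≢0 , ¬imaginary) =
        ((on-circle , λ e → v≢0 (cong proj₂ e)) , λ p∈ → [ u≢0 , v≢0 ]′ (on-axis p∈)) , ¬imaginary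

module LinkedPairs (F : FiniteField) (3≡0 : FF.3# F ≡ FiniteField.0# F) where

  open FiniteField F
  open FF F
  open FieldProperties F
  open Characteristic3 F 3≡0
  open Orbits F 3≡0
  open Circle F 3≡0
  open Counting

  Linked : Pred Point _
  Linked (μ , μ') = Adm μ × Adm μ' × μ ≢ μ' × OrbitWitness μ μ'

  Adm? : Decidable Adm
  Adm? μ = ¬? (μ ≟ 0#) ×-dec ¬? (μ ≟ 1#)

  OrbitWitness? : ∀ μ μ' → Dec (OrbitWitness μ μ')
  OrbitWitness? μ μ' = ∃? λ d →
    ¬? (d ≟ 0#) ×-dec ¬? (d ≟ 1#) ×-dec ¬? (d ≟ - 1#) ×-dec IsSquare? (1# - d * d) ×-dec
    ((order % 4 ℕ.≟ 1) →-dec ¬? (d * d ≟ - 1#)) ×-dec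
    (μ ≟ d * d * d * d) ×-dec (μ' ≟ d * d * d * d + d * d + 1#)

  Linked? : Decidable Linked
  Linked? (μ , μ') = Adm? μ ×-dec Adm? μ' ×-dec ¬? (μ ≟ μ') ×-dec OrbitWitness? μ μ'

  OrbitPair : Pred Point _
  OrbitPair (μ , μ') = Adm μ × Adm μ' × IsSquare μ × IsSquare μ' × μ ≢ μ' × SameOrbit μ μ'

  Linked⇒OrbitPair : ∀ {p} → Linked p → OrbitPair p
  Linked⇒OrbitPair (μ-adm , μ'-adm , μ≢μ' , w@(d , _ , _ , _ , _ , _ , refl , refl)) =
    μ-adm , μ'-adm , (d * d , sym (d⁴ d)) , (d * d - 1# , d⁴+d²+1 d) , μ≢μ' , OrbitWitness⇒SameOrbit w
    where
    d⁴ : ∀ d → d * d * d * d ≡ d * d * (d * d)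
    d⁴ = solve 1 (λ d → d :* d :* d :* d := d :* d :* (d :* d)) refl
    d⁴+d²+1 : ∀ d → (d * d - 1#) * (d * d - 1#) ≡ d * d * d * d + d * d + 1#
    d⁴+d²+1 = solve 1 (λ d → (d :* d :- :1) :* (d :* d :- :1) := d :* d :* d :* d :+ d :* d :+ :1) refl

  OrbitPair⇒Linked : ∀ {p} → OrbitPair p → Linked p
  OrbitPair⇒Linked (μ-adm , μ'-adm , _ , _ , μ≢μ' , orbit) =
    μ-adm , μ'-adm , μ≢μ' , SameOrbit⇒OrbitWitness μ-adm μ≢μ' orbit

  Linked-even : ∀ {m} → HasSize Linked m → 2 ∣ m
  Linked-even = Blocks⇒∣ _≟ₚ_ (involution-Blocks swap swap-closed swap-fixpoint-free (λ _ → refl))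
    where
    swap : Point → Point
    swap (μ , μ') = μ' , μ
    swap-closed : ∀ {p} → Linked p → Linked (swap p)
    swap-closed (μ-adm , μ'-adm , μ≢μ' , w) = μ'-adm , μ-adm , (λ μ'≡μ → μ≢μ' (sym μ'≡μ)) , OrbitWitness-sym w
    swap-fixpoint-free : ∀ {p} → Linked p → swap p ≢ p
    swap-fixpoint-free (_ , _ , μ≢μ' , _) swap≡p = μ≢μ' (cong proj₂ swap≡p)

  -- φ is 4-to-1 from Generic onto Linked: the fibre over the pair given by d is {±d} × {±r}.
  φ : Point → Point
  φ (u , v) = u * u * u * u , u * u * u * u + u * u + 1#

  Generic⇒Linked : ∀ {p} → Generic p → Linked (φ p)
  Generic⇒Linked {u , v} (on-circle , u≢0 , v≢0 , u²≢-1) =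
    (u⁴≢0 , u⁴≢1) , (u⁴+u²+1≢0 , u⁴+u²+1≢1) , u⁴≢u⁴+u²+1 ,
    u , u≢0 , (λ u≡1 → u²≢1 (trans (cong (λ x → x * x) u≡1) (*-identityˡ 1#))) ,
    (λ u≡-1 → u²≢1 (trans (cong (λ x → x * x) u≡-1) -1*-1≡1)) , (v , v²≡1-u²) , (λ _ → u²≢-1) , refl , refl
    where
    v²≡1-u² : v * v ≡ 1# - u * u
    v²≡1-u² = x-y≡0⇒x≡y (trans (v² u v) ⟨ on-circle ⟩)
      where
      v² : ∀ u v → v * v - (1# - u * u) ≡ 1# * (u * u + v * v - 1#)
      v² = solve 2 (λ u v → v :* v :- (:1 :- u :* u) := :1 :* (u :* u :+ v :* v :- :1)) refl
    u²≢1 : u * u ≢ 1#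
    u²≢1 u²≡1 = v≢0 (x*x≡0⇒x≡0 (trans v²≡1-u² (trans (cong (λ x → 1# - x) u²≡1) (-‿inverseʳ 1#))))
    u²-1≢0 : u * u - 1# ≢ 0#
    u²-1≢0 u²-1≡0 = u²≢1 (x-y≡0⇒x≡y u²-1≡0)
    u²+1≢0 : u * u + 1# ≢ 0#
    u²+1≢0 u²+1≡0 = u²≢-1 (inverseˡ-unique (u * u) 1# u²+1≡0)
    u⁴≢0 : u * u * u * u ≢ 0#
    u⁴≢0 = x*y≢0 (x*y≢0 (x*y≢0 u≢0 u≢0) u≢0) u≢0
    u⁴≢1 : u * u * u * u ≢ 1#
    u⁴≢1 u⁴≡1 = x*y≢0 u²-1≢0 u²+1≢0 (trans (u⁴-1 u) (x≡y⇒x-y≡0 u⁴≡1))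
      where
      u⁴-1 : ∀ u → (u * u - 1#) * (u * u + 1#) ≡ u * u * u * u - 1#
      u⁴-1 = solve 1 (λ u → (u :* u :- :1) :* (u :* u :+ :1) := u :* u :* u :* u :- :1) refl
    u⁴+u²+1≢0 : u * u * u * u + u * u + 1# ≢ 0#
    u⁴+u²+1≢0 u⁴+u²+1≡0 = x*y≢0 u²-1≢0 u²-1≢0 (trans (square u) u⁴+u²+1≡0)
      where
      square : ∀ u → (u * u - 1#) * (u * u - 1#) ≡ u * u * u * u + u * u + 1#
      square = solve 1 (λ u → (u :* u :- :1) :* (u :* u :- :1) := u :* u :* u :* u :+ u :* u :+ :1) refl
    u⁴+u²+1≢1 : u * u * u * u + u * u + 1# ≢ 1#
    u⁴+u²+1≢1 u⁴+u²+1≡1 = x*y≢0 (x*y≢0 u≢0 u≢0) u²+1≢0 (trans (u⁴+u² u) (x≡y⇒x-y≡0 u⁴+u²+1≡1))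
      where
      u⁴+u² : ∀ u → u * u * (u * u + 1#) ≡ u * u * u * u + u * u + 1# - 1#
      u⁴+u² = solve 1 (λ u → u :* u :* (u :* u :+ :1) := u :* u :* u :* u :+ u :* u :+ :1 :- :1) refl
    u⁴≢u⁴+u²+1 : u * u * u * u ≢ u * u * u * u + u * u + 1#
    u⁴≢u⁴+u²+1 u⁴≡u⁴+u²+1 = u²+1≢0 (trans (difference u) (x≡y⇒x-y≡0 (sym u⁴≡u⁴+u²+1)))
      where
      difference : ∀ u → u * u + 1# ≡ u * u * u * u + u * u + 1# - u * u * u * u
      difference = solve 1 (λ u → u :* u :+ :1 := u :* u :* u :* u :+ u :* u :+ :1 :- u :* u :* u :* u) refl

  φ-fibre : ∀ {p} → Linked p → HasSize (λ x → Generic x × φ x ≡ p) 4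
  φ-fibre ((_ , μ≢1) , _ , _ , d , d≢0 , d≢1 , d≢-1 , (r , r²≡1-d²) , _ , refl , refl) =
    HasSize-cong to from (HasSize-× (HasSize-√ d≢0) (HasSize-√ r≢0))
    where
    r≢0 = witness-r≢0 d≢1 d≢-1 r²≡1-d²
    x²≢0 : ∀ {x y} → x * x ≡ y * y → y ≢ 0# → x ≢ 0#
    x²≢0 x²≡y² y≢0 refl = y≢0 (x*x≡0⇒x≡0 (trans (sym x²≡y²) (zeroˡ 0#)))
    x⁴ : ∀ x → x * x * x * x ≡ x * x * (x * x)
    x⁴ = solve 1 (λ x → x :* x :* x :* x := x :* x :* (x :* x)) refl
    circle : ∀ u v d r → u * u + v * v - 1# ≡ 1# * (u * u - d * d) + 1# * (v * v - r * r) + 1# * (r * r - (1# - d * d))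
    circle = solve 4 (λ u v d r → u :* u :+ v :* v :- :1 := :1 :* (u :* u :- d :* d) :+ :1 :* (v :* v :- r :* r) :+ :1 :* (r :* r :- (:1 :- d :* d))) refl
    u² : ∀ u d → u * u - d * d ≡ 1# * (u * u * u * u + u * u + 1# - (d * d * d * d + d * d + 1#)) + (- 1#) * (u * u * u * u - d * d * d * d)
    u² = solve 2 (λ u d → u :* u :- d :* d := :1 :* (u :* u :* u :* u :+ u :* u :+ :1 :- (d :* d :* d :* d :+ d :* d :+ :1)) :+ (:- :1) :* (u :* u :* u :* u :- d :* d :* d :* d)) refl
    v² : ∀ u v d r → v * v - r * r ≡ 1# * (u * u + v * v - 1#) + (- 1#) * (u * u - d * d) + (- 1#) * (r * r - (1# - d * d))
    v² = solve 4 (λ u v d r → v :* v :- r :* r := :1 :* (u :* u :+ v :* v :- :1) :+ (:- :1) :* (u :* u :- d :* d) :+ (:- :1) :* (r :* r :- (:1 :- d :* d))) refl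
    to : ∀ {x} → (proj₁ x * proj₁ x ≡ d * d) × (proj₂ x * proj₂ x ≡ r * r) → Generic x × φ x ≡ (d * d * d * d , d * d * d * d + d * d + 1#)
    to {u , v} (u²≡d² , v²≡r²) =
      (trans (circle u v d r) (⟨ x≡y⇒x-y≡0 u²≡d² ⟩ ⊕ ⟨ x≡y⇒x-y≡0 v²≡r² ⟩ ⊕ ⟨ x≡y⇒x-y≡0 r²≡1-d² ⟩) ,
       x²≢0 u²≡d² d≢0 , x²≢0 v²≡r² r≢0 , λ u²≡-1 → μ≢1 (trans (x⁴ d) (trans (cong (λ x → x * x) (trans (sym u²≡d²) u²≡-1)) -1*-1≡1))) ,
      cong₂ _,_ u⁴≡d⁴ (cong₂ (λ x y → x + y + 1#) u⁴≡d⁴ u²≡d²)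
      where
      u⁴≡d⁴ : u * u * u * u ≡ d * d * d * d
      u⁴≡d⁴ = trans (x⁴ u) (trans (cong (λ x → x * x) u²≡d²) (sym (x⁴ d)))
    from : ∀ {x} → Generic x × φ x ≡ (d * d * d * d , d * d * d * d + d * d + 1#) → (proj₁ x * proj₁ x ≡ d * d) × (proj₂ x * proj₂ x ≡ r * r)
    from {u , v} ((on-circle , _) , φx≡) = x-y≡0⇒x≡y u²-d²≡0 , x-y≡0⇒x≡y (trans (v² u v d r) (⟨ on-circle ⟩ ⊕ ⟨ u²-d²≡0 ⟩ ⊕ ⟨ x≡y⇒x-y≡0 r²≡1-d² ⟩))
      where
      u²-d²≡0 : u * u - d * d ≡ 0#
      u²-d²≡0 = trans (u² u d) (⟨ x≡y⇒x-y≡0 (cong proj₂ φx≡) ⟩ ⊕ ⟨ x≡y⇒x-y≡0 (cong proj₁ φx≡) ⟩)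

  Linked-count : ∀ {n m} → HasSize (λ t → t * t ≡ - 1#) n → HasSize Linked m → order ∸ n ∸ 3 ∸ n *ℕ n ≡ 4 *ℕ m
  Linked-count roots linked = HasSize-fibres _≟ₚ_ φ (Generic-size roots) linked Generic⇒Linked φ-fibre

module OrbitCounts (F : FiniteField) (3≡0 : FF.3# F ≡ FiniteField.0# F) where

  open import Data.Nat.DivMod using ([m+kn]%n≡m%n; m*n/n≡m)

  open FiniteField F
  open FF F
  open FieldProperties F
  open Characteristic3 F 3≡0
  open Orbits F 3≡0
  open Circle F 3≡0
  open LinkedPairs F 3≡0
  open Counting

  Partner : Carrier → Carrier → Set
  Partner μ₁ μ = ∃ λ s → IsSquare s × μ₁ ≡ s * s × μ ≡ s * s + s + 1#

  partner : ∀ {μ₁ μ} → Adm μ₁ → μ₁ ≢ μ → SameOrbit μ₁ μ → Partner μ₁ μ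
  partner μ₁-adm μ₁≢μ orbit = from-witness (SameOrbit⇒OrbitWitness μ₁-adm μ₁≢μ orbit)
    where
    d⁴ : ∀ d → d * d * d * d ≡ d * d * (d * d)
    d⁴ = solve 1 (λ d → d :* d :* d :* d := d :* d :* (d :* d)) refl
    from-witness : ∀ {μ₁ μ} → OrbitWitness μ₁ μ → Partner μ₁ μ
    from-witness (d , _ , _ , _ , _ , _ , refl , refl) = d * d , (d , refl) , d⁴ d , cong (λ x → x + d * d + 1#) (d⁴ d)

  partners-equal : ∀ {s t μ ν} → s ≡ t → μ ≡ s * s + s + 1# → ν ≡ t * t + t + 1# → μ ≡ ν
  partners-equal refl μ≡ ν≡ = trans μ≡ (sym ν≡)

  opposite-squares : ∀ {s t} → IsSquare s → IsSquare t → t ≢ 0# → s ≡ - t → IsSquare (- 1#)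
  opposite-squares (d , refl) (e , refl) e²≢0 d²≡-e² =
    d * w , x-y≡0⇒x≡y (trans (identity d e w) (⟨ x≡y⇒x-y≡0 d²≡-e² ⟩ ⊕ ⟨ x≡y⇒x-y≡0 (x*x⁻¹≡1 e≢0) ⟩))
    where
    e≢0 : e ≢ 0#
    e≢0 refl = e²≢0 (zeroˡ 0#)
    w = e ⁻¹
    identity : ∀ d e w → d * w * (d * w) - - 1# ≡ (w * w) * (d * d - - (e * e)) + (- (e * w + 1#)) * (e * w - 1#)
    identity = solve 3 (λ d e w → d :* w :* (d :* w) :- :- :1 := (w :* w) :* (d :* d :- :- (e :* e)) :+ (:- (e :* w :+ :1)) :* (e :* w :- :1)) refl

  at-most-two : ¬ IsSquare (- 1#) → ∀ {μ₁ μ₂ μ₃} → Adm μ₁ → μ₁ ≢ μ₂ → μ₁ ≢ μ₃ → μ₂ ≢ μ₃ →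
                SameOrbit μ₁ μ₂ → SameOrbit μ₁ μ₃ → ⊥
  at-most-two ¬□-1 {μ₁} {μ₂} {μ₃} (μ₁≢0 , μ₁≢1) μ₁≢μ₂ μ₁≢μ₃ μ₂≢μ₃ orbit₂ orbit₃ =
    two-partners (partner (μ₁≢0 , μ₁≢1) μ₁≢μ₂ orbit₂) (partner (μ₁≢0 , μ₁≢1) μ₁≢μ₃ orbit₃)
    where
    two-partners : Partner μ₁ μ₂ → Partner μ₁ μ₃ → ⊥
    two-partners (s , □s , μ₁≡s² , μ₂≡) (t , □t , μ₁≡t² , μ₃≡) =
      [ (λ s≡t → μ₂≢μ₃ (partners-equal s≡t μ₂≡ μ₃≡)) , (λ s≡-t → ¬□-1 (opposite-squares □s □t t≢0 s≡-t)) ]′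
        (x*x≡y*y⇒x≡y⊎x≡-y (trans (sym μ₁≡s²) μ₁≡t²))
      where
      t≢0 : t ≢ 0#
      t≢0 refl = μ₁≢0 (trans μ₁≡t² (zeroˡ 0#))

  at-most-three : ∀ {μ₁ μ₂ μ₃ μ₄} → Adm μ₁ → μ₁ ≢ μ₂ → μ₁ ≢ μ₃ → μ₁ ≢ μ₄ → μ₂ ≢ μ₃ → μ₂ ≢ μ₄ → μ₃ ≢ μ₄ →
                  SameOrbit μ₁ μ₂ → SameOrbit μ₁ μ₃ → SameOrbit μ₁ μ₄ → ⊥
  at-most-three {μ₁} {μ₂} {μ₃} {μ₄} μ₁-adm μ₁≢μ₂ μ₁≢μ₃ μ₁≢μ₄ μ₂≢μ₃ μ₂≢μ₄ μ₃≢μ₄ orbit₂ orbit₃ orbit₄ =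
    three-partners (partner μ₁-adm μ₁≢μ₂ orbit₂) (partner μ₁-adm μ₁≢μ₃ orbit₃) (partner μ₁-adm μ₁≢μ₄ orbit₄)
    where
    three-partners : Partner μ₁ μ₂ → Partner μ₁ μ₃ → Partner μ₁ μ₄ → ⊥
    three-partners (s , _ , μ₁≡s² , μ₂≡) (t , _ , μ₁≡t² , μ₃≡) (u , _ , μ₁≡u² , μ₄≡) =
      [ (λ t≡s → μ₂≢μ₃ (partners-equal (sym t≡s) μ₂≡ μ₃≡))
      , (λ t≡-s → [ (λ u≡s → μ₂≢μ₄ (partners-equal (sym u≡s) μ₂≡ μ₄≡))
                  , (λ u≡-s → μ₃≢μ₄ (partners-equal (trans t≡-s (sym u≡-s)) μ₃≡ μ₄≡))
                  ]′ (x*x≡y*y⇒x≡y⊎x≡-y (trans (sym μ₁≡u²) μ₁≡s²)))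
      ]′ (x*x≡y*y⇒x≡y⊎x≡-y (trans (sym μ₁≡t²) μ₁≡s²))

  nonsquare-alone : ∀ {μ μ'} → Adm μ → ¬ IsSquare μ → μ ≢ μ' → ¬ SameOrbit μ μ'
  nonsquare-alone μ-adm ¬□μ μ≢μ' orbit = let (s , _ , μ≡s² , _) = partner μ-adm μ≢μ' orbit in ¬□μ (s , sym μ≡s²)

  private
    q%4≡c%4 : ∀ {q c j} → c ≤ q → q ∸ c ≡ 4 *ℕ j → q % 4 ≡ c % 4
    q%4≡c%4 {q} {c} {j} c≤q q-c≡4j =
      trans (cong (_% 4) (trans (sym (ℕ.m+[n∸m]≡n c≤q)) (cong (c +ℕ_) (trans q-c≡4j (ℕ.*-comm 4 j)))))
            ([m+kn]%n≡m%n c j 4)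

    2*[x/8]≡m : ∀ {x m k} → x ≡ 4 *ℕ m → m ≡ k *ℕ 2 → 2 *ℕ (x / 8) ≡ m
    2*[x/8]≡m {k = k} refl refl =
      trans (cong (λ y → 2 *ℕ (y / 8)) (4*[k*2]≡k*8 k)) (trans (cong (2 *ℕ_) (m*n/n≡m k 8)) (ℕ.*-comm 2 k))
      where
      4*[k*2]≡k*8 : ∀ k → 4 *ℕ (k *ℕ 2) ≡ k *ℕ 8
      4*[k*2]≡k*8 k = trans (sym (ℕ.*-assoc 4 k 2)) (trans (cong (_*ℕ 2) (ℕ.*-comm 4 k)) (ℕ.*-assoc k 4 2))

  OrbitPair-size : 9 ≤ order →
    (IsSquare (- 1#) × order % 4 ≡ 1 × HasSize OrbitPair (2 *ℕ ((order ∸ 9) / 8))) ⊎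
    (¬ IsSquare (- 1#) × order % 4 ≡ 3 × HasSize OrbitPair (2 *ℕ ((order ∸ 3) / 8)))
  OrbitPair-size 9≤q =
    sizes (HasSize-filter HasSize-Carrier (λ _ → tt) (λ t → t * t ≟ - 1#)) (HasSize-filter HasSize-Point (λ _ → tt) Linked?)
    where
    sizes : ∃ (HasSize (λ t → t * t ≡ - 1#)) → ∃ (HasSize Linked) → _
    sizes (n , roots) (m , linked) = by-cases (Linked-even linked) (Linked-count roots linked) (IsSquare? (- 1#))
      where
      pairs = HasSize-cong Linked⇒OrbitPair OrbitPair⇒Linked linked
      by-cases : 2 ∣ m → order ∸ n ∸ 3 ∸ n *ℕ n ≡ 4 *ℕ m → Dec (IsSquare (- 1#)) → _
      by-cases (divides k m≡2k) count (yes (i , i²≡-1)) =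
        inj₁ ((i , i²≡-1) , q%4≡c%4 {j = m} 9≤q q-9≡4m , subst (HasSize OrbitPair) (sym (2*[x/8]≡m {k = k} q-9≡4m m≡2k)) pairs)
        where
        i≢0 : i ≢ 0#
        i≢0 refl = -1≢0 (trans (sym i²≡-1) (zeroˡ 0#))
        n≡2 : n ≡ 2
        n≡2 = HasSize-unique roots (HasSize-cong (λ t²≡i² → trans t²≡i² i²≡-1) (λ t²≡-1 → trans t²≡-1 (sym i²≡-1)) (HasSize-√ i≢0))
        q-9≡4m : order ∸ 9 ≡ 4 *ℕ m
        q-9≡4m = trans (sym (trans (ℕ.∸-+-assoc (order ∸ 2) 3 4) (ℕ.∸-+-assoc order 2 7)))
                       (subst (λ n → order ∸ n ∸ 3 ∸ n *ℕ n ≡ 4 *ℕ m) n≡2 count)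
      by-cases (divides k m≡2k) count (no ¬□-1) =
        inj₂ (¬□-1 , q%4≡c%4 {j = m} 3≤q q-3≡4m , subst (HasSize OrbitPair) (sym (2*[x/8]≡m {k = k} q-3≡4m m≡2k)) pairs)
        where
        3≤q : 3 ≤ order
        3≤q = ℕ.≤-trans (s≤s (s≤s (s≤s z≤n))) 9≤q
        n≡0 : n ≡ 0
        n≡0 = HasSize-empty roots (λ t²≡-1 → ¬□-1 (_ , t²≡-1))
        q-3≡4m : order ∸ 3 ≡ 4 *ℕ m
        q-3≡4m = subst (λ n → order ∸ n ∸ 3 ∸ n *ℕ n ≡ 4 *ℕ m) n≡0 count

lemma6p4 : (F : FiniteField) →
    let open FiniteField F
        open FF F
        q = order
    in 9 ≤ q → q % 3 ≡ 0 →
    -- (i)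
    ((μ μ' : Carrier) → Adm μ → Adm μ' → μ ≢ μ' →
       (SameOrbit μ μ' →
          ∃ λ d → d ≢ 0# × d ≢ 1# × d ≢ - 1# × IsSquare (1# - d * d)
            × (q % 4 ≡ 1 → d * d ≢ - 1#)
            × μ ≡ d * d * d * d × μ' ≡ d * d * d * d + d * d + 1#)
     × ((∃ λ d → d ≢ 0# × d ≢ 1# × d ≢ - 1# × IsSquare (1# - d * d)
            × (q % 4 ≡ 1 → d * d ≢ - 1#)
            × μ ≡ d * d * d * d × μ' ≡ d * d * d * d + d * d + 1#)
          → SameOrbit μ μ'))
    -- (ii)
    × ((μ μ' : Carrier) → Adm μ → Adm μ' → ¬ IsSquare μ → ¬ IsSquare μ' →
         μ ≢ μ' → ¬ SameOrbit μ μ')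
    -- (iii), q ≡ -1 (mod 4)
    × (q % 4 ≡ 3 →
         ((μ₁ μ₂ μ₃ : Carrier) → Adm μ₁ → Adm μ₂ → Adm μ₃ →
            IsSquare μ₁ → IsSquare μ₂ → IsSquare μ₃ →
            μ₁ ≢ μ₂ → μ₁ ≢ μ₃ → μ₂ ≢ μ₃ →
            SameOrbit μ₁ μ₂ → SameOrbit μ₁ μ₃ → ⊥)
       × HasSize (λ (p : Carrier × Carrier) → let (μ , μ') = p in
             Adm μ × Adm μ' × IsSquare μ × IsSquare μ' × μ ≢ μ' × SameOrbit μ μ')
           (2 *ℕ ((q ∸ 3) / 8)))
    -- (iii), q ≡ 1 (mod 4)
    × (q % 4 ≡ 1 →
         ((μ₁ μ₂ μ₃ μ₄ : Carrier) → Adm μ₁ → Adm μ₂ → Adm μ₃ → Adm μ₄ →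
            IsSquare μ₁ → IsSquare μ₂ → IsSquare μ₃ → IsSquare μ₄ →
            μ₁ ≢ μ₂ → μ₁ ≢ μ₃ → μ₁ ≢ μ₄ → μ₂ ≢ μ₃ → μ₂ ≢ μ₄ → μ₃ ≢ μ₄ →
            SameOrbit μ₁ μ₂ → SameOrbit μ₁ μ₃ → SameOrbit μ₁ μ₄ → ⊥)
       × HasSize (λ (p : Carrier × Carrier) → let (μ , μ') = p in
             Adm μ × Adm μ' × IsSquare μ × IsSquare μ' × μ ≢ μ' × SameOrbit μ μ')
           (2 *ℕ ((q ∸ 9) / 8)))
lemma6p4 F 9≤q q%3≡0 =
  (λ μ μ' μ-adm _ μ≢μ' → SameOrbit⇒OrbitWitness μ-adm μ≢μ' , OrbitWitness⇒SameOrbit) ,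
  (λ μ μ' μ-adm _ ¬□μ _ μ≢μ' → nonsquare-alone μ-adm ¬□μ μ≢μ') ,
  (λ q%4≡3 → [ (λ (_ , q%4≡1 , _) → ⊥-elim (1≢3 (trans (sym q%4≡1) q%4≡3)))
             , (λ (¬□-1 , _ , size) → (λ _ _ _ μ₁-adm _ _ _ _ _ → at-most-two ¬□-1 μ₁-adm) , size)
             ]′ (OrbitPair-size 9≤q)) ,
  (λ q%4≡1 → [ (λ (_ , _ , size) → (λ _ _ _ _ μ₁-adm _ _ _ _ _ _ _ → at-most-three μ₁-adm) , size)
             , (λ (_ , q%4≡3 , _) → ⊥-elim (1≢3 (trans (sym q%4≡1) q%4≡3)))
             ]′ (OrbitPair-size 9≤q))
  where
  open FiniteField F
  3≡0 : FF.3# F ≡ 0#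
  3≡0 = Characteristic.3∣order⇒3≡0 F (m%n≡0⇒n∣m order 3 q%3≡0)
  open Orbits F 3≡0
  open OrbitCounts F 3≡0
  1≢3 : 1 ≢ 3
  1≢3 ()
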